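{- Let $\Gamma$ be a weighted digraph with forest dimension $v$, let $K$ be an undominated knot of $\Gamma$, and let $\bar J=(\bar J_{ij})=Q_{n-v}/\varepsilon(\mathcal F_{n-v})$. Then: 1. $\bar J$ is stochastic: $\bar J_{ij}\ge0$ and $\sum_{k=1}^n\bar J_{ik}=1$ for all $i,j$. 2. $\bar J_{ij}\neq0$ if and only if $j\in\tilde K$ and $i$ is reachable from $j$ in $\Gamma$. 3. If $j\in K$, then for every $i\in V(\Gamma)$, $\bar J_{ij}=\varepsilon(\mathcal T^j)\varepsilon(\mathcal P^{K\to i})/\varepsilon(\mathcal F_{n-v})$; furthermore, if $i\in K^+$ then $\bar J_{ij}=\bar J_{jj}=\varepsilon(\mathcal T^j)/\varepsilon(\mathcal T)$. 4. $\sum_{j\in K}\bar J_{jj}=1$; in particular, if $j$ is an undominated vertex, $\bar J_{jj}=1$. 5. If $j_1,j_2\in K$, the $j_2$-th column of $\bar J$ equals $\bigl(\varepsilon(\mathcal T^{j_2})/\varepsilon(\mathcal T^{j_1})\bigr)$ times its $j_1$-th column.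
   Context: $\Gamma$: loopless digraph on $V(\Gamma)=\{1,\dots,n\}$, $n>1$, arc weights $\varepsilon_{ij}>0$. Weight of a subgraph = product of its arc weights (1 if no arcs); weight of a set of subgraphs = sum of weights (0 if empty). $w$ is reachable from $z$ if $w=z$ or there is a directed path from $z$ to $w$. A vertex is undominated if its indegree is 0. A diverging forest is a digraph without circuits with all indegrees $\le1$; roots are indegree-0 vertices; each weak component is a tree diverging from a root. A maximum out forest of $\Gamma$ is a spanning diverging forest with the maximum number of arcs; its number of roots is the forest dimension $v$. $\mathcal F_k$: spanning diverging forests of $\Gamma$ with $k$ arcs; $\mathcal F_k^{j\to i}$: those in which $i$ lies in the tree rooted at $j$; $Q_{n-v}=(\varepsilon(\mathcal F^{j\to i}_{n-v}))_{i,j}$. An undominated knot is a nonempty $K\subseteq V(\Gamma)$ whose vertices are mutually reachable with no arc from outside $K$ into $K$. $\tilde K$: union of all undominated knots; $K^+$: vertices reachable from $K$ and unreachable from all other undominated knots. $\Gamma_K$: induced subgraph on $K$; $\Gamma_{ -K}$: spanning subgraph with arc set $E(\Gamma)\setminus E(\Gamma_K)$. $\mathcal T$: spanning diverging trees of $\Gamma_K$; $\mathcal T^j$: those diverging from $j$; $\mathcal P$: maximum out forests of $\Gamma_{ -K}$; $\mathcal P^{K\to i}$: those in which $i$ is reachable from some vertex of $K$.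
   Formalization: The arc weights $\varepsilon_{ij}$ are positive rationals. -}

module Defs where

open import Data.Bool using (Bool; true; false; _∧_; _∨_; not; if_then_else_)
open import Data.Nat as ℕ using (ℕ; zero; suc; _∸_; _⊔_; _≡ᵇ_)
open import Data.Fin using (Fin; _≟_)
open import Data.Vec using (Vec; []; _∷_; lookup)
open import Data.List as List using (List; []; _∷_; allFin; filterᵇ; foldr; concatMap)
open import Data.Bool.ListAction using (any; all)
open import Data.Maybe using (Maybe; nothing; just; is-just; is-nothing)
open import Data.Rational using (ℚ; 0ℚ; 1ℚ; _+_; _*_; _÷_; ≢-nonZero)
open import Data.Rational.Properties using () renaming (_≟_ to _≟ℚ_)
open import Relation.Nullary using (yes; no)
open import Data.Product using (Σ; _×_)
open import Data.Empty using (⊥)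
open import Relation.Nullary.Decidable using (⌊_⌋)
open import Relation.Binary.PropositionalEquality using (_≡_)

-- A digraph on V = Fin n, given by its arc relation: Arc n i j = true iff i → j is an arc.
Arcs : ℕ → Set
Arcs n = Fin n → Fin n → Bool

Loopless : ∀ {n} → Arcs n → Set
Loopless {n} A = (i : Fin n) → A i i ≡ false

Weights : ℕ → Set
Weights n = Fin n → Fin n → ℚ

VSet : ℕ → Set
VSet n = Vec Bool n

_∈ᵇ_ : ∀ {n} → Fin n → VSet n → Bool
i ∈ᵇ K = lookup K i

data Reach {n} (A : Arcs n) : Fin n → Fin n → Set where
  here : ∀ {z} → Reach A z z
  step : ∀ {z y w} → A z y ≡ true → Reach A y w → Reach A z w

Undominated : ∀ {n} → Arcs n → Fin n → Set
Undominated {n} A j = (a : Fin n) → A a j ≡ false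

record UndomKnot {n} (A : Arcs n) (K : VSet n) : Set where
  field
    nonempty  : Σ (Fin n) (λ k → (k ∈ᵇ K) ≡ true)
    mutual-reach : ∀ a b → (a ∈ᵇ K) ≡ true → (b ∈ᵇ K) ≡ true → Reach A a b
    no-entering  : ∀ a b → A a b ≡ true → (b ∈ᵇ K) ≡ true → (a ∈ᵇ K) ≡ true

-- Spanning subgraphs with indegrees ≤ 1, encoded by parent vectors:
-- P[i] = just j  means that the arc j → i belongs to the subgraph;
-- P[i] = nothing means that i has indegree 0 in the subgraph.
-- (Bijective encoding of spanning subgraphs with all indegrees ≤ 1.)

Par : ℕ → Set
Par n = Vec (Maybe (Fin n)) n

-- all such encodings (each exactly once)
allVecs : ∀ {X : Set} (m : ℕ) → List X → List (Vec X m)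
allVecs zero    xs = [] ∷ []
allVecs (suc m) xs = concatMap (λ x → List.map (x ∷_) (allVecs m xs)) xs

allPar : (n : ℕ) → List (Par n)
allPar n = allVecs n (nothing ∷ List.map just (allFin n))

-- anc k P i j : j is reached from i by going back along at most k arcs of P,
-- i.e. there is a directed path (of length ≤ k) from j to i in P (j = i allowed).
anc : ∀ {n} → ℕ → Par n → Fin n → Fin n → Bool
anc zero    P i j = ⌊ i ≟ j ⌋
anc (suc k) P i j with lookup P i
... | nothing = ⌊ i ≟ j ⌋
... | just p  = ⌊ i ≟ j ⌋ ∨ anc k P p j

-- P contains a circuit: some arc p → i of P closes a directed path i ⇝ p in P.
-- (Paths in P have length < n, so the bound n loses nothing.)
hasCircuit : ∀ {n} → Par n → Bool
hasCircuit {n} P = any (λ i → closes i (lookup P i)) (allFin n)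
  where
  closes : Fin n → Maybe (Fin n) → Bool
  closes i nothing  = false
  closes i (just p) = anc n P p i

subOf : ∀ {n} → Arcs n → Par n → Bool
subOf {n} A P = all (λ i → ok i (lookup P i)) (allFin n)
  where
  ok : Fin n → Maybe (Fin n) → Bool
  ok i nothing  = true
  ok i (just j) = A j i

isForest : ∀ {n} → Arcs n → Par n → Bool
isForest A P = subOf A P ∧ not (hasCircuit P)

nArcs : ∀ {n} → Par n → ℕ
nArcs {n} P = List.length (filterᵇ (λ i → is-just (lookup P i)) (allFin n))

isRoot : ∀ {n} → Par n → Fin n → Bool
isRoot P j = is-nothing (lookup P j)

inTree : ∀ {n} → Par n → Fin n → Fin n → Bool
inTree {n} P j i = isRoot P j ∧ anc n P i j

wt : ∀ {n} → Weights n → Par n → ℚ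
wt {n} ε P = foldr (λ i r → f i (lookup P i) * r) 1ℚ (allFin n)
  where
  f : Fin n → Maybe (Fin n) → ℚ
  f i nothing  = 1ℚ
  f i (just j) = ε j i

wset : ∀ {n} → Weights n → (Par n → Bool) → ℚ
wset {n} ε S = foldr (λ P r → wt ε P + r) 0ℚ (filterᵇ S (allPar n))

maxArcs : ∀ {n} → Arcs n → ℕ
maxArcs {n} A = foldr (λ P r → nArcs P ⊔ r) 0 (filterᵇ (isForest A) (allPar n))

-- forest dimension: number of roots of a maximum out forest (= n − max #arcs)
forestDim : ∀ {n} → Arcs n → ℕ
forestDim {n} A = n ∸ maxArcs A

𝓕 : ∀ {n} → Arcs n → ℕ → Par n → Bool
𝓕 A k P = isForest A P ∧ (nArcs P ≡ᵇ k)

𝓕→ : ∀ {n} → Arcs n → ℕ → Fin n → Fin n → Par n → Bool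
𝓕→ A k j i P = 𝓕 A k P ∧ inTree P j i

Q : ∀ {n} → Arcs n → Weights n → Fin n → Fin n → ℚ
Q {n} A ε i j = wset ε (𝓕→ A (n ∸ forestDim A) j i)

ε𝓕 : ∀ {n} → Arcs n → Weights n → ℚ
ε𝓕 {n} A ε = wset ε (𝓕 A (n ∸ forestDim A))

-- division (the denominators used below are positive; x / 0 := 0 is a mere convention)
_/ℚ_ : ℚ → ℚ → ℚ
p /ℚ q with q ≟ℚ 0ℚ
... | yes _  = 0ℚ
... | no q≢0 = _÷_ p q {{≢-nonZero q≢0}}

Jbar : ∀ {n} → Arcs n → Weights n → Fin n → Fin n → ℚ
Jbar A ε i j = Q A ε i j /ℚ ε𝓕 A ε

InKtilde : ∀ {n} → Arcs n → Fin n → Set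
InKtilde {n} A j = Σ (VSet n) (λ K' → UndomKnot A K' × ((j ∈ᵇ K') ≡ true))

record InKplus {n} (A : Arcs n) (K : VSet n) (i : Fin n) : Set where
  field
    fromK    : Σ (Fin n) (λ k → (k ∈ᵇ K) ≡ true × Reach A k i)
    notOther : (K' : VSet n) → UndomKnot A K' → (K' ≡ K → ⊥) →
               (k : Fin n) → (k ∈ᵇ K') ≡ true → Reach A k i → ⊥

inducedArcs : ∀ {n} → Arcs n → VSet n → Arcs n
inducedArcs A K a b = A a b ∧ (a ∈ᵇ K) ∧ (b ∈ᵇ K)

minusArcs : ∀ {n} → Arcs n → VSet n → Arcs n
minusArcs A K a b = A a b ∧ not ((a ∈ᵇ K) ∧ (b ∈ᵇ K))

-- 𝓣^j : spanning diverging trees of Γ_K diverging from j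
-- (a tree on vertex set K is encoded by a parent vector that is `nothing` outside K)
𝓣from : ∀ {n} → Arcs n → VSet n → Fin n → Par n → Bool
𝓣from {n} A K j P =
  (j ∈ᵇ K) ∧ isForest (inducedArcs A K) P ∧
  all (λ i → if i ∈ᵇ K then inTree P j i else is-nothing (lookup P i)) (allFin n)

𝓣 : ∀ {n} → Arcs n → VSet n → Par n → Bool
𝓣 {n} A K P = any (λ j → 𝓣from A K j P) (allFin n)

𝓟 : ∀ {n} → Arcs n → VSet n → Par n → Bool
𝓟 A K P = isForest (minusArcs A K) P ∧ (nArcs P ≡ᵇ maxArcs (minusArcs A K))

𝓟K→ : ∀ {n} → Arcs n → VSet n → Fin n → Par n → Bool
𝓟K→ {n} A K i P = 𝓟 A K P ∧ any (λ k → (k ∈ᵇ K) ∧ anc n P i k) (allFin n)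

Σv : ∀ {n} → (Fin n → ℚ) → ℚ
Σv {n} f = foldr (λ k r → f k + r) 0ℚ (allFin n)

ΣK : ∀ {n} → VSet n → (Fin n → ℚ) → ℚ
ΣK K f = Σv (λ j → if j ∈ᵇ K then f j else 0ℚ)

{-# OPTIONS --safe #-}

-- Since no arc enters the undominated knot K, a spanning diverging forest F of Γ splits into the arcs
-- entering K, a forest of Γ_K, and the remaining arcs, a forest of Γ₋K; conversely any such pair
-- glues back to a forest of Γ. Counting arcs gives (n − v) + 1 = |K| + (arcs of a maximum forest of
-- Γ₋K), so F is a maximum out forest exactly when its K-part is a spanning tree of Γ_K and its other
-- part is a maximum out forest of Γ₋K. For j ∈ K, the vertex i then lies in the tree of F rooted at j
-- iff that spanning tree diverges from j and i hangs below K in the other part, so the weight sums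
-- factor: Q_ij = ε(𝓣^j) ε(𝓟^{K→i}) and ε(𝓕_{n−v}) = ε(𝓣) ε(𝓟). Items 3–5 are algebra on these
-- factorisations, and item 1 holds because every vertex lies in exactly one tree of each forest.
-- Item 2 rests on two exchange arguments. Re-hanging everything reachable from a vertex s on a
-- breadth-first tree keeps a forest and keeps every parent except possibly that of s. So a root r of a
-- maximum forest lies in an undominated knot: an arc a → b entering the knot of r would let us hang the
-- vertices reachable from b below a, giving r a parent at no cost. And for j in an undominated knot
-- and i reachable from j, re-hanging from j loses at most the parent of j, which the old root of j's
-- tree (in the same knot, hence reachable from j) regains.

module Submission where

open import Data.Bool using (Bool; true; false; _∧_; _∨_; not; if_then_else_)
open import Data.Bool.Properties using (∧-conicalˡ; ∧-conicalʳ; ∧-identityʳ; ∧-zeroʳ; not-injective; T-≡)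
open import Data.Bool.ListAction using (any; all)
open import Data.Empty using (⊥; ⊥-elim)
open import Data.Fin as Fin using (Fin; zero; suc; _≟_; toℕ)
import Data.Fin.Properties as Finₚ
open import Data.List as List using (List; []; _∷_; allFin; filterᵇ; foldr; concatMap; _++_)
open import Data.List.Membership.Propositional using (_∈_)
open import Data.List.Membership.Propositional.Properties using (∈-allFin; ∈-map⁺; ∈-concatMap⁺)
open import Data.List.Relation.Unary.Any as Any using (here; there)
open import Data.Maybe using (Maybe; nothing; just; is-just; is-nothing)
open import Data.Nat as ℕ using (ℕ; zero; suc; z≤n; s≤s; _∸_; _<_)
import Data.Nat.Properties as ℕₚ
open import Data.Nat.Tactic.RingSolver using (solve-∀)
open import Data.Vec as Vec using (Vec; []; _∷_; lookup)
import Data.Vec.Properties as Vecₚ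
open import Data.Product using (Σ; ∃; _×_; _,_; proj₁; proj₂; map₂)
open import Data.Sum using (_⊎_; inj₁; inj₂)
open import Function using (_∘_; id; _⇔_; mk⇔; Equivalence)
open import Relation.Nullary using (¬_; yes; no)
open import Relation.Nullary.Decidable using (⌊_⌋)
open import Relation.Binary.PropositionalEquality

open import Algebra.Bundles using (CommutativeRing)
open import Data.Rational using (ℚ; 0ℚ; 1ℚ; _+_; _*_; _≤_; 1/_; ≢-nonZero) renaming (_<_ to _<ℚ_)
import Data.Rational.Properties as ℚₚ
open import Data.Rational.Properties using () renaming (_≟_ to _≟ℚ_)
open import Data.Rational.Solver using (module +-*-Solver)
open import Algebra.Properties.Semiring.Sum (CommutativeRing.semiring ℚₚ.+-*-commutativeRing)
  using (sum; ∑-distrib-+; sum-cong-≗; *-distribʳ-sum; sum-replicate-zero)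
open import Algebra.Properties.CommutativeMonoid.Sum ℚₚ.*-1-commutativeMonoid
  using () renaming (sum to ∏; ∑-distrib-+ to ∏-distrib-*; sum-cong-≗ to ∏-cong)

open import Defs

bool-cases : (b : Bool) → b ≡ true ⊎ b ≡ false
bool-cases true  = inj₁ refl
bool-cases false = inj₂ refl

true≢false : ∀ {b} → b ≡ true → b ≡ false → ⊥
true≢false refl ()

∧-intro : ∀ {a b} → a ≡ true → b ≡ true → a ∧ b ≡ true
∧-intro refl refl = refl

∧-falseˡ : ∀ {a} b → a ≡ false → a ∧ b ≡ false
∧-falseˡ b refl = refl

if-true : ∀ {A : Set} {b} {x y : A} → b ≡ true → (if b then x else y) ≡ x
if-true refl = refl

if-false : ∀ {A : Set} {b} {x y : A} → b ≡ false → (if b then x else y) ≡ y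
if-false refl = refl

∨-introˡ : ∀ {a} b → a ≡ true → a ∨ b ≡ true
∨-introˡ b refl = refl

∨-introʳ : ∀ a {b} → b ≡ true → a ∨ b ≡ true
∨-introʳ true  _ = refl
∨-introʳ false h = h

∨-elim : ∀ {a b} → a ∨ b ≡ true → a ≡ true ⊎ b ≡ true
∨-elim {true}  _ = inj₁ refl
∨-elim {false} h = inj₂ h

not-true : ∀ {a} → not a ≡ true → a ≡ false
not-true {false} _ = refl

not-false : ∀ {a} → a ≡ false → not a ≡ true
not-false refl = refl

bool-ext : ∀ {a b} → (a ≡ true → b ≡ true) → (b ≡ true → a ≡ true) → a ≡ b
bool-ext {true}          a⇒b _   = sym (a⇒b refl)
bool-ext {false} {false} _   _   = refl
bool-ext {false} {true}  _   b⇒a = b⇒a refl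

≟-true : ∀ {n} {i j : Fin n} → ⌊ i ≟ j ⌋ ≡ true → i ≡ j
≟-true {i = i} {j} h with i ≟ j
... | yes i≡j = i≡j

≟-refl : ∀ {n} (i : Fin n) → ⌊ i ≟ i ⌋ ≡ true
≟-refl i with i ≟ i
... | yes _  = refl
... | no i≢i = ⊥-elim (i≢i refl)

≟-false : ∀ {n} {i j : Fin n} → i ≢ j → ⌊ i ≟ j ⌋ ≡ false
≟-false {i = i} {j} i≢j with i ≟ j
... | yes i≡j = ⊥-elim (i≢j i≡j)
... | no _    = refl

module _ {X : Set} (f : X → Bool) where

  all⁻ : ∀ {xs} → all f xs ≡ true → ∀ {x} → x ∈ xs → f x ≡ true
  all⁻ {_ ∷ _}  h (here refl) = ∧-conicalˡ _ _ h
  all⁻ {x ∷ xs} h (there x∈) = all⁻ (∧-conicalʳ (f x) _ h) x∈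

  all⁺ : ∀ xs → (∀ {x} → x ∈ xs → f x ≡ true) → all f xs ≡ true
  all⁺ []       _     = refl
  all⁺ (x ∷ xs) every = ∧-intro (every (here refl)) (all⁺ xs (every ∘ there))

  all-false : ∀ xs → all f xs ≡ false → Σ X λ x → f x ≡ false
  all-false (x ∷ xs) h with bool-cases (f x)
  ... | inj₂ fx = x , fx
  ... | inj₁ fx rewrite fx = all-false xs h

  any⁻ : ∀ {xs} → any f xs ≡ true → Σ X λ x → f x ≡ true
  any⁻ {x ∷ xs} h with ∨-elim {f x} h
  ... | inj₁ fx = x , fx
  ... | inj₂ rest = any⁻ {xs} rest

  any⁺ : ∀ {xs x} → x ∈ xs → f x ≡ true → any f xs ≡ true
  any⁺ {y ∷ ys} (here refl) fx = ∨-introˡ (any f ys) fx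
  any⁺ {y ∷ ys} (there x∈) fx = ∨-introʳ (f y) (any⁺ {ys} x∈ fx)

  any-false : ∀ {xs} → any f xs ≡ false → ∀ {x} → x ∈ xs → f x ≡ false
  any-false h {x} x∈ with bool-cases (f x)
  ... | inj₁ fx = ⊥-elim (true≢false (any⁺ x∈ fx) h)
  ... | inj₂ fx = fx

module _ {n : ℕ} (f : Fin n → Bool) where

  all-allFin⁻ : all f (allFin n) ≡ true → ∀ i → f i ≡ true
  all-allFin⁻ h i = all⁻ f h (∈-allFin i)

  all-allFin⁺ : (∀ i → f i ≡ true) → all f (allFin n) ≡ true
  all-allFin⁺ h = all⁺ f (allFin n) (λ {i} _ → h i)

  any-allFin⁺ : ∀ i → f i ≡ true → any f (allFin n) ≡ true
  any-allFin⁺ i = any⁺ f (∈-allFin i)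

count : ∀ {n} → (Fin n → Bool) → ℕ
count {zero}  f = 0
count {suc n} f = if f zero then suc (count (f ∘ suc)) else count (f ∘ suc)

length-filter-allFin : ∀ {n} (f : Fin n → Bool) → List.length (filterᵇ f (allFin n)) ≡ count f
length-filter-allFin {n} f = go n id
  where
  go : ∀ m (g : Fin m → Fin n) → List.length (filterᵇ f (List.tabulate g)) ≡ count (f ∘ g)
  go zero g = refl
  go (suc m) g with f (g zero)
  ... | true  = cong suc (go m (g ∘ suc))
  ... | false = go m (g ∘ suc)

count-cong : ∀ {n} {f g : Fin n → Bool} → (∀ i → f i ≡ g i) → count f ≡ count g
count-cong {zero}          f≗g = refl
count-cong {suc n} {f} {g} f≗g rewrite f≗g zero with g zero
... | true  = cong suc (count-cong (f≗g ∘ suc))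
... | false = count-cong (f≗g ∘ suc)

count≤n : ∀ {n} (f : Fin n → Bool) → count f ℕ.≤ n
count≤n {zero}  f = z≤n
count≤n {suc n} f with f zero
... | true  = s≤s (count≤n (f ∘ suc))
... | false = ℕₚ.m≤n⇒m≤1+n (count≤n (f ∘ suc))

count-zero : ∀ {n} (f : Fin n → Bool) → (∀ i → f i ≡ false) → count f ≡ 0
count-zero {zero}  f none = refl
count-zero {suc n} f none rewrite none zero = count-zero (f ∘ suc) (none ∘ suc)

count-mono : ∀ {n} {f g : Fin n → Bool} → (∀ i → f i ≡ true → g i ≡ true) → count f ℕ.≤ count g
count-mono {zero}          f⇒g = z≤n
count-mono {suc n} {f} {g} f⇒g with f zero in fz | g zero in gz
... | true  | true  = s≤s (count-mono (f⇒g ∘ suc))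
... | false | true  = ℕₚ.m≤n⇒m≤1+n (count-mono (f⇒g ∘ suc))
... | false | false = count-mono (f⇒g ∘ suc)
... | true  | false = ⊥-elim (true≢false (f⇒g zero fz) gz)

count-mono-< : ∀ {n} {f g : Fin n → Bool} → (∀ i → f i ≡ true → g i ≡ true) →
               ∀ x → f x ≡ false → g x ≡ true → count f < count g
count-mono-< {suc n} {f} {g} f⇒g zero fx gx rewrite fx | gx = s≤s (count-mono (f⇒g ∘ suc))
count-mono-< {suc n} {f} {g} f⇒g (suc x) fx gx with f zero in fz | g zero in gz
... | true  | true  = s≤s (count-mono-< (f⇒g ∘ suc) x fx gx)
... | false | true  = ℕₚ.m<n⇒m<1+n (count-mono-< (f⇒g ∘ suc) x fx gx)
... | false | false = count-mono-< (f⇒g ∘ suc) x fx gx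
... | true  | false = ⊥-elim (true≢false (f⇒g zero fz) gz)

count-pos : ∀ {n} (f : Fin n → Bool) x → f x ≡ true → 1 ℕ.≤ count f
count-pos {suc n} f zero    fx rewrite fx = s≤s z≤n
count-pos {suc n} f (suc x) fx with f zero
... | true  = s≤s z≤n
... | false = count-pos (f ∘ suc) x fx

count-split : ∀ {n} (f g : Fin n → Bool) →
              count f ≡ count (λ i → f i ∧ g i) ℕ.+ count (λ i → f i ∧ not (g i))
count-split {zero}  f g = refl
count-split {suc n} f g with f zero | g zero
... | true  | true  = cong suc (count-split (f ∘ suc) (g ∘ suc))
... | true  | false = trans (cong suc (count-split (f ∘ suc) (g ∘ suc))) (sym (ℕₚ.+-suc _ _))
... | false | _     = count-split (f ∘ suc) (g ∘ suc)

count≤1 : ∀ {n} (f : Fin n → Bool) → (∀ i i′ → f i ≡ true → f i′ ≡ true → i ≡ i′) → count f ℕ.≤ 1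
count≤1 {zero}  f unique = z≤n
count≤1 {suc n} f unique with f zero in fz
... | true  = ℕₚ.≤-reflexive (cong suc (count-zero (f ∘ suc) none-after))
  where
  none-after : ∀ i → f (suc i) ≡ false
  none-after i with bool-cases (f (suc i))
  ... | inj₂ fi = fi
  ... | inj₁ fi with unique zero (suc i) fz fi
  ... | ()
... | false = count≤1 (f ∘ suc) (λ i i′ fi fi′ → Finₚ.suc-injective (unique (suc i) (suc i′) fi fi′))

count-one : ∀ {n} (f : Fin n → Bool) j → f j ≡ true → (∀ i → f i ≡ true → i ≡ j) → count f ≡ 1
count-one f j fj unique =
  ℕₚ.≤-antisym (count≤1 f (λ i i′ fi fi′ → trans (unique i fi) (sym (unique i′ fi′)))) (count-pos f j fj)

count-exchange : ∀ {n} (f g : Fin n → Bool) j r → r ≢ j → (∀ x → x ≢ j → f x ≡ true → g x ≡ true) →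
                 f r ≡ false → g r ≡ true → count f ℕ.≤ count g
count-exchange f g j r r≢j f⇒g fr gr = begin
  count f                           ≡⟨ count-split f is-j ⟩
  count (λ x → f x ∧ is-j x) ℕ.+ count f-else   ≤⟨ ℕₚ.+-monoˡ-≤ _ at-j ⟩
  1 ℕ.+ count f-else                ≤⟨ count-mono-< f-else⇒g r (cong (_∧ not (is-j r)) fr) gr ⟩
  count g                           ∎
  where
  open ℕₚ.≤-Reasoning
  is-j : _ → Bool
  is-j x = ⌊ x ≟ j ⌋
  f-else : _ → Bool
  f-else x = f x ∧ not (is-j x)
  at-j : count (λ x → f x ∧ is-j x) ℕ.≤ 1
  at-j = count≤1 _ (λ x x′ hx hx′ → trans (≟-true (∧-conicalʳ (f x) _ hx)) (sym (≟-true (∧-conicalʳ (f x′) _ hx′))))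
  f-else⇒g : ∀ x → f-else x ≡ true → g x ≡ true
  f-else⇒g x h with x ≟ j | ∧-conicalʳ (f x) _ h
  ... | no x≢j | _ = f⇒g x x≢j (∧-conicalˡ _ _ h)

count-two : ∀ {n} (f : Fin n → Bool) a b → a ≢ b → f a ≡ true → f b ≡ true → 2 ℕ.≤ count f
count-two {suc n} f zero    zero    a≢b fa fb = ⊥-elim (a≢b refl)
count-two {suc n} f zero    (suc b) a≢b fa fb rewrite fa = s≤s (count-pos (f ∘ suc) b fb)
count-two {suc n} f (suc a) zero    a≢b fa fb = count-two f zero (suc a) (a≢b ∘ sym) fb fa
count-two {suc n} f (suc a) (suc b) a≢b fa fb with f zero
... | true  = ℕₚ.m≤n⇒m≤1+n (count-two (f ∘ suc) a b (a≢b ∘ cong suc) fa fb)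
... | false = count-two (f ∘ suc) a b (a≢b ∘ cong suc) fa fb

nonneg+nonneg : ∀ {p q} → 0ℚ ≤ p → 0ℚ ≤ q → 0ℚ ≤ p + q
nonneg+nonneg = ℚₚ.+-mono-≤

pos+nonneg : ∀ {p q} → 0ℚ <ℚ p → 0ℚ ≤ q → 0ℚ <ℚ p + q
pos+nonneg = ℚₚ.+-mono-<-≤

nonneg+pos : ∀ {p q} → 0ℚ ≤ p → 0ℚ <ℚ q → 0ℚ <ℚ p + q
nonneg+pos = ℚₚ.+-mono-≤-<

nonneg*nonneg : ∀ {p q} → 0ℚ ≤ p → 0ℚ ≤ q → 0ℚ ≤ p * q
nonneg*nonneg {p} {q} 0≤p 0≤q = ℚₚ.nonNegative⁻¹ _
  {{ℚₚ.nonNeg*nonNeg⇒nonNeg p {{Data.Rational.nonNegative 0≤p}} q {{Data.Rational.nonNegative 0≤q}}}}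

pos*pos : ∀ {p q} → 0ℚ <ℚ p → 0ℚ <ℚ q → 0ℚ <ℚ p * q
pos*pos {p} {q} 0<p 0<q = ℚₚ.positive⁻¹ _
  {{ℚₚ.pos*pos⇒pos p {{Data.Rational.positive 0<p}} q {{Data.Rational.positive 0<q}}}}

pos⇒≢0 : ∀ {q} → 0ℚ <ℚ q → q ≢ 0ℚ
pos⇒≢0 0<q q≡0 = ℚₚ.<-irrefl (sym q≡0) 0<q

sum-zero : ∀ {n} (f : Fin n → ℚ) → (∀ i → f i ≡ 0ℚ) → sum f ≡ 0ℚ
sum-zero {n} f f≗0 = trans (sum-cong-≗ f≗0) (sum-replicate-zero n)

sum-single : ∀ {n} (f : Fin n → ℚ) j → (∀ i → i ≢ j → f i ≡ 0ℚ) → sum f ≡ f j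
sum-single {suc n} f zero    off = trans (cong (f zero +_) (sum-zero (f ∘ suc) (λ i → off (suc i) (λ ()))))
                                         (ℚₚ.+-identityʳ (f zero))
sum-single {suc n} f (suc j) off = trans (cong (_+ sum (f ∘ suc)) (off zero (λ ())))
  (trans (ℚₚ.+-identityˡ _) (sum-single (f ∘ suc) j (λ i i≢j → off (suc i) (i≢j ∘ Finₚ.suc-injective))))

Σv≡sum : ∀ {n} (f : Fin n → ℚ) → Σv f ≡ sum f
Σv≡sum {n} f = go n id
  where
  go : ∀ m (g : Fin m → Fin n) → foldr (λ k r → f k + r) 0ℚ (List.tabulate g) ≡ sum (f ∘ g)
  go zero    g = refl
  go (suc m) g = cong (f (g zero) +_) (go m (g ∘ suc))

∏-pos : ∀ {n} (f : Fin n → ℚ) → (∀ i → 0ℚ <ℚ f i) → 0ℚ <ℚ ∏ f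
∏-pos {zero}  f pos = ℚₚ.positive⁻¹ 1ℚ
∏-pos {suc n} f pos = pos*pos (pos zero) (∏-pos (f ∘ suc) (pos ∘ suc))

∑ₗ : {X : Set} → List X → (X → ℚ) → ℚ
∑ₗ xs f = foldr (λ x r → f x + r) 0ℚ xs

select : {X : Set} → (X → Bool) → (X → ℚ) → X → ℚ
select S f x = if S x then f x else 0ℚ

module _ {X : Set} where

  ∑ₗ-cong : ∀ xs {f g : X → ℚ} → (∀ x → f x ≡ g x) → ∑ₗ xs f ≡ ∑ₗ xs g
  ∑ₗ-cong []       f≗g = refl
  ∑ₗ-cong (x ∷ xs) f≗g = cong₂ _+_ (f≗g x) (∑ₗ-cong xs f≗g)

  ∑ₗ-zero : ∀ xs (f : X → ℚ) → (∀ x → f x ≡ 0ℚ) → ∑ₗ xs f ≡ 0ℚ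
  ∑ₗ-zero []       f f≗0 = refl
  ∑ₗ-zero (x ∷ xs) f f≗0 rewrite f≗0 x | ∑ₗ-zero xs f f≗0 = refl

  ∑ₗ-++ : ∀ xs ys (f : X → ℚ) → ∑ₗ (xs ++ ys) f ≡ ∑ₗ xs f + ∑ₗ ys f
  ∑ₗ-++ []       ys f = sym (ℚₚ.+-identityˡ _)
  ∑ₗ-++ (x ∷ xs) ys f = trans (cong (f x +_) (∑ₗ-++ xs ys f)) (sym (ℚₚ.+-assoc (f x) _ _))

  ∑ₗ-*ʳ : ∀ xs (c : ℚ) (f : X → ℚ) → ∑ₗ xs (λ x → f x * c) ≡ ∑ₗ xs f * c
  ∑ₗ-*ʳ []       c f = sym (ℚₚ.*-zeroˡ c)
  ∑ₗ-*ʳ (x ∷ xs) c f = trans (cong (f x * c +_) (∑ₗ-*ʳ xs c f)) (sym (ℚₚ.*-distribʳ-+ c (f x) _))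

  ∑ₗ-*ˡ : ∀ xs (c : ℚ) (f : X → ℚ) → ∑ₗ xs (λ x → c * f x) ≡ c * ∑ₗ xs f
  ∑ₗ-*ˡ []       c f = sym (ℚₚ.*-zeroʳ c)
  ∑ₗ-*ˡ (x ∷ xs) c f = trans (cong (c * f x +_) (∑ₗ-*ˡ xs c f)) (sym (ℚₚ.*-distribˡ-+ c (f x) _))

  ∑ₗ-nonneg : ∀ xs (f : X → ℚ) → (∀ x → 0ℚ ≤ f x) → 0ℚ ≤ ∑ₗ xs f
  ∑ₗ-nonneg []       f nonneg = ℚₚ.≤-refl
  ∑ₗ-nonneg (x ∷ xs) f nonneg = nonneg+nonneg (nonneg x) (∑ₗ-nonneg xs f nonneg)

  ∑ₗ-pos : ∀ xs (f : X → ℚ) → (∀ x → 0ℚ ≤ f x) → ∀ {y} → y ∈ xs → 0ℚ <ℚ f y → 0ℚ <ℚ ∑ₗ xs f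
  ∑ₗ-pos (x ∷ xs) f nonneg (here refl) 0<fy = pos+nonneg 0<fy (∑ₗ-nonneg xs f nonneg)
  ∑ₗ-pos (x ∷ xs) f nonneg (there y∈)  0<fy = nonneg+pos (nonneg x) (∑ₗ-pos xs f nonneg y∈ 0<fy)

  ∑ₗ-select-≢0 : ∀ xs (S : X → Bool) (f : X → ℚ) → ∑ₗ xs (select S f) ≢ 0ℚ → Σ X λ x → S x ≡ true
  ∑ₗ-select-≢0 []       S f ≢0 = ⊥-elim (≢0 refl)
  ∑ₗ-select-≢0 (x ∷ xs) S f ≢0 with bool-cases (S x)
  ... | inj₁ Sx = x , Sx
  ... | inj₂ Sx rewrite Sx = ∑ₗ-select-≢0 xs S f (≢0 ∘ trans (ℚₚ.+-identityˡ _))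

  ∑ₗ-sum : ∀ {n} xs (f : X → Fin n → ℚ) → ∑ₗ xs (λ x → sum (f x)) ≡ sum (λ k → ∑ₗ xs (λ x → f x k))
  ∑ₗ-sum {n} []       f = sym (sum-zero {n} (λ _ → 0ℚ) (λ _ → refl))
  ∑ₗ-sum     (x ∷ xs) f = trans (cong (sum (f x) +_) (∑ₗ-sum xs f)) (sym (∑-distrib-+ (f x) _))

  ∑ₗ-filter : ∀ xs (S : X → Bool) (f : X → ℚ) → ∑ₗ (filterᵇ S xs) f ≡ ∑ₗ xs (select S f)
  ∑ₗ-filter []       S f = refl
  ∑ₗ-filter (x ∷ xs) S f with S x
  ... | true  = cong (f x +_) (∑ₗ-filter xs S f)
  ... | false = trans (∑ₗ-filter xs S f) (sym (ℚₚ.+-identityˡ _))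

∑ₗ-map : {X Y : Set} (g : X → Y) (xs : List X) (f : Y → ℚ) → ∑ₗ (List.map g xs) f ≡ ∑ₗ xs (f ∘ g)
∑ₗ-map g []       f = refl
∑ₗ-map g (x ∷ xs) f = cong (f (g x) +_) (∑ₗ-map g xs f)

∑ₗ-concatMap : {X Y : Set} (g : X → List Y) (xs : List X) (f : Y → ℚ) →
               ∑ₗ (concatMap g xs) f ≡ ∑ₗ xs (λ x → ∑ₗ (g x) f)
∑ₗ-concatMap g []       f = refl
∑ₗ-concatMap g (x ∷ xs) f = trans (∑ₗ-++ (g x) (concatMap g xs) f) (cong (∑ₗ (g x) f +_) (∑ₗ-concatMap g xs f))

keep : {Y : Set} → Bool → Maybe Y → Maybe Y
keep b x = if b then x else nothing

inside : ∀ {Y : Set} {m} → Vec Bool m → Vec (Maybe Y) m → Vec (Maybe Y) m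
inside = Vec.zipWith keep

outside : ∀ {Y : Set} {m} → Vec Bool m → Vec (Maybe Y) m → Vec (Maybe Y) m
outside K = inside (Vec.map not K)

lookup-inside : ∀ {Y : Set} {m} (K : Vec Bool m) (v : Vec (Maybe Y) m) i →
                lookup (inside K v) i ≡ keep (lookup K i) (lookup v i)
lookup-inside K v i = Vecₚ.lookup-zipWith keep i K v

lookup-outside : ∀ {Y : Set} {m} (K : Vec Bool m) (v : Vec (Maybe Y) m) i →
                 lookup (outside K v) i ≡ keep (not (lookup K i)) (lookup v i)
lookup-outside K v i = trans (lookup-inside (Vec.map not K) v i) (cong (λ b → keep b (lookup v i)) (Vecₚ.lookup-map i not K))

supportedIn : ∀ {Y : Set} {m} → Vec Bool m → Vec (Maybe Y) m → Bool
supportedIn []      []      = true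
supportedIn (b ∷ K) (x ∷ v) = (b ∨ is-nothing x) ∧ supportedIn K v

supportedIn-intro : ∀ {Y : Set} {m} (K : Vec Bool m) (v : Vec (Maybe Y) m) →
                    (∀ i → lookup K i ≡ false → lookup v i ≡ nothing) → supportedIn K v ≡ true
supportedIn-intro []           []      _   = refl
supportedIn-intro (true  ∷ K) (x ∷ v) out = supportedIn-intro K v (out ∘ suc)
supportedIn-intro (false ∷ K) (x ∷ v) out rewrite out zero refl = supportedIn-intro K v (out ∘ suc)

module _ {Y : Set} (zs : List Y) where

  private
    options : List (Maybe Y)
    options = nothing ∷ List.map just zs

    vectors : ∀ m → List (Vec (Maybe Y) m)
    vectors m = allVecs m options

  ∑-vectors-suc : ∀ m (f : Vec (Maybe Y) (suc m) → ℚ) →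
                  ∑ₗ (vectors (suc m)) f ≡ ∑ₗ options (λ x → ∑ₗ (vectors m) (f ∘ (x ∷_)))
  ∑-vectors-suc m f = trans (∑ₗ-concatMap (λ x → List.map (x ∷_) (vectors m)) options f)
                            (∑ₗ-cong options (λ x → ∑ₗ-map (x ∷_) (vectors m) f))

  ∑-supportedIn-true : ∀ m (K : Vec Bool m) (a : Vec (Maybe Y) (suc m) → ℚ) →
    ∑ₗ (vectors (suc m)) (select (supportedIn (true ∷ K)) a)
      ≡ ∑ₗ options (λ x → ∑ₗ (vectors m) (select (supportedIn K) (a ∘ (x ∷_))))
  ∑-supportedIn-true m K a = ∑-vectors-suc m (select (supportedIn (true ∷ K)) a)

  ∑-supportedIn-false : ∀ m (K : Vec Bool m) (a : Vec (Maybe Y) (suc m) → ℚ) →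
    ∑ₗ (vectors (suc m)) (select (supportedIn (false ∷ K)) a)
      ≡ ∑ₗ (vectors m) (select (supportedIn K) (a ∘ (nothing ∷_)))
  ∑-supportedIn-false m K a = begin
    ∑ₗ (vectors (suc m)) (select (supportedIn (false ∷ K)) a)
      ≡⟨ ∑-vectors-suc m (select (supportedIn (false ∷ K)) a) ⟩
    nothing-part + ∑ₗ (List.map just zs) just-part
      ≡⟨ cong (nothing-part +_) (trans (∑ₗ-map just zs just-part) (∑ₗ-zero zs _ (λ _ → ∑ₗ-zero (vectors m) _ (λ _ → refl)))) ⟩
    nothing-part + 0ℚ
      ≡⟨ ℚₚ.+-identityʳ _ ⟩
    nothing-part ∎
    where
    open ≡-Reasoning
    nothing-part : ℚ
    nothing-part = ∑ₗ (vectors m) (select (supportedIn K) (a ∘ (nothing ∷_)))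
    just-part : Maybe Y → ℚ
    just-part x = ∑ₗ (vectors m) (select (supportedIn (false ∷ K)) a ∘ (x ∷_))

  -- A vector splits uniquely into its part inside K and its part outside K, whence the double sum.
  ∑-inside-outside : ∀ m (K : Vec Bool m) (a b : Vec (Maybe Y) m → ℚ) →
    ∑ₗ (vectors m) (λ v → a (inside K v) * b (outside K v))
      ≡ ∑ₗ (vectors m) (select (supportedIn K) a) * ∑ₗ (vectors m) (select (supportedIn (Vec.map not K)) b)
  ∑-inside-outside zero [] a b = begin
    a [] * b [] + 0ℚ               ≡⟨ ℚₚ.+-identityʳ _ ⟩
    a [] * b []                    ≡⟨ cong₂ _*_ (ℚₚ.+-identityʳ (a [])) (ℚₚ.+-identityʳ (b [])) ⟨
    (a [] + 0ℚ) * (b [] + 0ℚ)      ∎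
    where open ≡-Reasoning
  ∑-inside-outside (suc m) (true ∷ K) a b = begin
    ∑ₗ (vectors (suc m)) (λ v → a (inside (true ∷ K) v) * b (outside (true ∷ K) v))
      ≡⟨ ∑-vectors-suc m (λ v → a (inside (true ∷ K) v) * b (outside (true ∷ K) v)) ⟩
    ∑ₗ options (λ x → ∑ₗ (vectors m) (λ v → a (x ∷ inside K v) * b (nothing ∷ outside K v)))
      ≡⟨ ∑ₗ-cong options (λ x → ∑-inside-outside m K (a ∘ (x ∷_)) (b ∘ (nothing ∷_))) ⟩
    ∑ₗ options (λ x → ∑ₗ (vectors m) (select (supportedIn K) (a ∘ (x ∷_))) * β)
      ≡⟨ ∑ₗ-*ʳ options β (λ x → ∑ₗ (vectors m) (select (supportedIn K) (a ∘ (x ∷_)))) ⟩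
    ∑ₗ options (λ x → ∑ₗ (vectors m) (select (supportedIn K) (a ∘ (x ∷_)))) * β
      ≡⟨ cong₂ _*_ (∑-supportedIn-true m K a) (∑-supportedIn-false m (Vec.map not K) b) ⟨
    ∑ₗ (vectors (suc m)) (select (supportedIn (true ∷ K)) a) *
    ∑ₗ (vectors (suc m)) (select (supportedIn (Vec.map not (true ∷ K))) b) ∎
    where
    open ≡-Reasoning
    β = ∑ₗ (vectors m) (select (supportedIn (Vec.map not K)) (b ∘ (nothing ∷_)))
  ∑-inside-outside (suc m) (false ∷ K) a b = begin
    ∑ₗ (vectors (suc m)) (λ v → a (inside (false ∷ K) v) * b (outside (false ∷ K) v))
      ≡⟨ ∑-vectors-suc m (λ v → a (inside (false ∷ K) v) * b (outside (false ∷ K) v)) ⟩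
    ∑ₗ options (λ x → ∑ₗ (vectors m) (λ v → a (nothing ∷ inside K v) * b (x ∷ outside K v)))
      ≡⟨ ∑ₗ-cong options (λ x → ∑-inside-outside m K (a ∘ (nothing ∷_)) (b ∘ (x ∷_))) ⟩
    ∑ₗ options (λ x → α * ∑ₗ (vectors m) (select (supportedIn (Vec.map not K)) (b ∘ (x ∷_))))
      ≡⟨ ∑ₗ-*ˡ options α (λ x → ∑ₗ (vectors m) (select (supportedIn (Vec.map not K)) (b ∘ (x ∷_)))) ⟩
    α * ∑ₗ options (λ x → ∑ₗ (vectors m) (select (supportedIn (Vec.map not K)) (b ∘ (x ∷_))))
      ≡⟨ cong₂ _*_ (∑-supportedIn-false m K a) (∑-supportedIn-true m (Vec.map not K) b) ⟨
    ∑ₗ (vectors (suc m)) (select (supportedIn (false ∷ K)) a) *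
    ∑ₗ (vectors (suc m)) (select (supportedIn (Vec.map not (false ∷ K))) b) ∎
    where
    open ≡-Reasoning
    α = ∑ₗ (vectors m) (select (supportedIn K) (a ∘ (nothing ∷_)))

data Climb {n} (P : Par n) : ℕ → Fin n → Fin n → Set where
  stay : ∀ {i} → Climb P 0 i i
  up   : ∀ {t i p j} → lookup P i ≡ just p → Climb P t p j → Climb P (suc t) i j

module _ {n} {P : Par n} where

  anc⇒Climb : ∀ k {i j} → anc k P i j ≡ true → ∃ λ t → t ℕ.≤ k × Climb P t i j
  anc⇒Climb zero    h rewrite ≟-true h = 0 , z≤n , stay
  anc⇒Climb (suc k) {i} {j} h with lookup P i in e
  ... | nothing rewrite ≟-true h = 0 , z≤n , stay
  ... | just p with ∨-elim {⌊ i ≟ j ⌋} h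
  ...   | inj₁ i≡j rewrite ≟-true i≡j = 0 , z≤n , stay
  ...   | inj₂ h′ with anc⇒Climb k h′
  ...     | t , t≤k , c = suc t , s≤s t≤k , up e c

  Climb⇒anc : ∀ {t i j} → Climb P t i j → ∀ k → t ℕ.≤ k → anc k P i j ≡ true
  Climb⇒anc {i = i} stay zero    _ = ≟-refl i
  Climb⇒anc {i = i} stay (suc k) _ with lookup P i
  ... | nothing = ≟-refl i
  ... | just _  rewrite ≟-refl i = refl
  Climb⇒anc {i = i} {j} (up e c) (suc k) (s≤s t≤k) rewrite e = ∨-introʳ ⌊ i ≟ j ⌋ (Climb⇒anc c k t≤k)

  climb-++ : ∀ {t t′ i j k} → Climb P t i j → Climb P t′ j k → Climb P (t ℕ.+ t′) i k
  climb-++ stay     c′ = c′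
  climb-++ (up e c) c′ = up e (climb-++ c c′)

  climb-from-root : ∀ {t r j} → lookup P r ≡ nothing → Climb P t r j → j ≡ r
  climb-from-root er stay      = refl
  climb-from-root er (up e c) with trans (sym er) e
  ... | ()

  climb-to-roots-unique : ∀ {t t′ i r r′} → Climb P t i r → lookup P r ≡ nothing →
                          Climb P t′ i r′ → lookup P r′ ≡ nothing → r ≡ r′
  climb-to-roots-unique stay     _  stay       _   = refl
  climb-to-roots-unique stay     er (up e′ _)  _   with trans (sym er) e′
  ... | ()
  climb-to-roots-unique (up e _) _  stay       er′ with trans (sym er′) e
  ... | ()
  climb-to-roots-unique (up e c) er (up e′ c′) er′ with trans (sym e) e′
  ... | refl = climb-to-roots-unique c er c′ er′

  position : ∀ {t i j} → Climb P t i j → Fin (suc t) → Fin n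
  position {i = i} c        zero    = i
  position         (up _ c) (suc k) = position c k

  prefix : ∀ {t i j} (c : Climb P t i j) l → Climb P (toℕ l) i (position c l)
  prefix c        zero    = stay
  prefix (up e c) (suc l) = up e (prefix c l)

  segment : ∀ {t i j} (c : Climb P t i j) k l → k Fin.< l →
            Climb P (suc (toℕ l ∸ suc (toℕ k))) (position c k) (position c l)
  segment (up e c) zero    (suc l) _         = up e (prefix c l)
  segment (up e c) (suc k) (suc l) (s≤s k<l) = segment c k l k<l

hasParent : ∀ {n} → Par n → Fin n → Bool
hasParent P i = is-just (lookup P i)

nArcs≡count : ∀ {n} (P : Par n) → nArcs P ≡ count (hasParent P)
nArcs≡count P = length-filter-allFin (hasParent P)

Acyclic : ∀ {n} → Par n → Set
Acyclic {n} P = ∀ {t i} → t ℕ.≤ n → ¬ Climb P (suc t) i i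

SubgraphOf : ∀ {n} → Arcs n → Par n → Set
SubgraphOf A P = ∀ i j → lookup P i ≡ just j → A j i ≡ true

record IsForest {n} (A : Arcs n) (P : Par n) : Set where
  constructor mkForest
  field
    subgraph : SubgraphOf A P
    acyclic  : Acyclic P
open IsForest public

module _ {n} {A : Arcs n} {P : Par n} where

  -- `subOf` and `hasCircuit` test a predicate local to their definitions on every `lookup P i`;
  -- abstracting over `lookup P i` with `with` lets that predicate compute.
  subOf⇒SubgraphOf : subOf A P ≡ true → SubgraphOf A P
  subOf⇒SubgraphOf h i j e with lookup P i | all-allFin⁻ _ h i
  subOf⇒SubgraphOf h i j refl | just .j | ok = ok

  hasCircuit⇒Acyclic : hasCircuit P ≡ false → Acyclic P
  hasCircuit⇒Acyclic h {t} {i} t≤n (up e c) with lookup P i | any-false _ h (∈-allFin i)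
  hasCircuit⇒Acyclic h {t} {i} t≤n (up refl c) | just p | open-path =
    true≢false (Climb⇒anc c n t≤n) open-path

  isForest⇒IsForest : isForest A P ≡ true → IsForest A P
  isForest⇒IsForest h = mkForest (subOf⇒SubgraphOf (∧-conicalˡ _ _ h))
                                 (hasCircuit⇒Acyclic (not-true (∧-conicalʳ (subOf A P) _ h)))

  IsForest⇒isForest : IsForest A P → isForest A P ≡ true
  IsForest⇒isForest (mkForest sub ac) with subOf A P in s | hasCircuit P in c
  ... | true  | false = refl
  ... | false | _     with all-false _ (allFin n) s
  ...   | i , bad with lookup P i in e
  ...     | just j = ⊥-elim (true≢false (sub i j e) bad)
  IsForest⇒isForest (mkForest sub ac) | true | true with any⁻ _ {allFin n} c
  ...   | i , closes with lookup P i in e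
  ...     | just p with anc⇒Climb n closes
  ...       | t , t≤n , cl = ⊥-elim (ac t≤n (up e cl))

module _ {n} {P : Par n} (ac : Acyclic P) where

  -- Pigeonhole: a climb of n steps visits some vertex twice, and the part in between is a cycle.
  no-climb-of-length-n : ∀ {i j} → ¬ Climb P n i j
  no-climb-of-length-n c with Finₚ.pigeonhole (ℕₚ.n<1+n n) (position c)
  ... | k , l , k<l , same = ac short (subst (λ x → Climb P _ x (position c l)) same (segment c k l k<l))
    where
    short : toℕ l ∸ suc (toℕ k) ℕ.≤ n
    short = ℕₚ.≤-trans (ℕₚ.m∸n≤m (toℕ l) (suc (toℕ k))) (Finₚ.toℕ≤pred[n] l)

  climb-prefix : ∀ m {t i j} → Climb P (m ℕ.+ t) i j → ∃ λ x → Climb P m i x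
  climb-prefix zero    c        = _ , stay
  climb-prefix (suc m) (up e c) with climb-prefix m c
  ... | x , c′ = x , up e c′

  climb-bounded : ∀ {t i j} → Climb P t i j → t < n
  climb-bounded {t} c with ℕₚ.<-≤-connex t n
  ... | inj₁ t<n = t<n
  ... | inj₂ n≤t with climb-prefix n (subst (λ l → Climb P l _ _) (sym (ℕₚ.m+[n∸m]≡n n≤t)) c)
  ...   | _ , c′ = ⊥-elim (no-climb-of-length-n c′)

  climb-to-root : ∀ i → ∃ λ r → lookup P r ≡ nothing × ∃ λ t → Climb P t i r
  climb-to-root i with ascend n i
    where
    ascend : ∀ k i → (∃ λ r → lookup P r ≡ nothing × ∃ λ t → Climb P t i r) ⊎ (∃ λ x → Climb P k i x)
    ascend zero    i = inj₂ (i , stay)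
    ascend (suc k) i with lookup P i in e
    ... | nothing = inj₁ (i , e , 0 , stay)
    ... | just p with ascend k p
    ...   | inj₁ (r , er , t , c) = inj₁ (r , er , suc t , up e c)
    ...   | inj₂ (x , c)          = inj₂ (x , up e c)
  ... | inj₁ found  = found
  ... | inj₂ (_ , c) = ⊥-elim (no-climb-of-length-n c)

  root⇒inTree : ∀ {t i r} → lookup P r ≡ nothing → Climb P t i r → inTree P r i ≡ true
  root⇒inTree er c rewrite er = Climb⇒anc c n (ℕₚ.<⇒≤ (climb-bounded c))

  tree-of : ∀ i → ∃ λ r → inTree P r i ≡ true
  tree-of i with climb-to-root i
  ... | r , er , _ , c = r , root⇒inTree er c

inTree⇒root : ∀ {n} {P : Par n} {j i} → inTree P j i ≡ true → lookup P j ≡ nothing × ∃ λ t → Climb P t i j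
inTree⇒root {n} {P} {j} h with lookup P j | h
... | nothing | h′ = refl , map₂ proj₂ (anc⇒Climb n h′)

inTree-unique : ∀ {n} {P : Par n} {j j′ i} → inTree P j i ≡ true → inTree P j′ i ≡ true → j ≡ j′
inTree-unique h h′ with inTree⇒root h | inTree⇒root h′
... | er , _ , c | er′ , _ , c′ = climb-to-roots-unique c er c′ er′

_⊑_ : ∀ {n} → Par n → Par n → Set
_⊑_ {n} G P = ∀ (i p : Fin n) → lookup G i ≡ just p → lookup P i ≡ just p

climb-⊑ : ∀ {n} {G P : Par n} → G ⊑ P → ∀ {t i j} → Climb G t i j → Climb P t i j
climb-⊑ G⊑P stay     = stay
climb-⊑ G⊑P (up e c) = up (G⊑P _ _ e) (climb-⊑ G⊑P c)

acyclic-⊑ : ∀ {n} {G P : Par n} → G ⊑ P → Acyclic P → Acyclic G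
acyclic-⊑ G⊑P ac t≤n cycle = ac t≤n (climb-⊑ G⊑P cycle)

module _ {n} {A : Arcs n} where

  reach-snoc : ∀ {z y w} → Reach A z y → A y w ≡ true → Reach A z w
  reach-snoc here       e′ = step e′ here
  reach-snoc (step e r) e′ = step e (reach-snoc r e′)

  reach-trans : ∀ {a b c} → Reach A a b → Reach A b c → Reach A a c
  reach-trans here       r′ = r′
  reach-trans (step e r) r′ = step e (reach-trans r r′)

  climb⇒reach : ∀ {P : Par n} → SubgraphOf A P → ∀ {t i j} → Climb P t i j → Reach A j i
  climb⇒reach sub stay     = here
  climb⇒reach sub (up e c) = reach-snoc (climb⇒reach sub c) (sub _ _ e)

reach-mono : ∀ {n} {A B : Arcs n} → (∀ a b → A a b ≡ true → B a b ≡ true) → ∀ {x y} → Reach A x y → Reach B x y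
reach-mono A⊆B here       = here
reach-mono A⊆B (step e r) = step (A⊆B _ _ e) (reach-mono A⊆B r)

least : (ℕ → Bool) → ℕ → ℕ
least p zero    = zero
least p (suc N) = if p zero then zero else suc (least (p ∘ suc) N)

least-holds : ∀ (p : ℕ → Bool) N k → k ℕ.≤ N → p k ≡ true → p (least p N) ≡ true
least-holds p zero    zero    _   pk = pk
least-holds p (suc N) k       k≤N pk with p zero in p0
... | true = p0
least-holds p (suc N) zero    _   pk | false = ⊥-elim (true≢false pk p0)
least-holds p (suc N) (suc k) k≤N pk | false = least-holds (p ∘ suc) N k (ℕₚ.≤-pred k≤N) pk

least-minimal : ∀ (p : ℕ → Bool) N k → p k ≡ true → least p N ℕ.≤ k
least-minimal p zero    k       pk = z≤n
least-minimal p (suc N) k       pk with p zero in p0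
... | true = z≤n
least-minimal p (suc N) zero    pk | false = ⊥-elim (true≢false pk p0)
least-minimal p (suc N) (suc k) pk | false = s≤s (least-minimal (p ∘ suc) N k pk)

below-least : ∀ (p : ℕ → Bool) N k → k < least p N → p k ≡ false
below-least p (suc N) k       k< with p zero in p0
below-least p (suc N) zero    k<       | false = p0
below-least p (suc N) (suc k) (s≤s k<) | false = below-least (p ∘ suc) N k k<

first : ∀ {n} → (Fin n → Bool) → Maybe (Fin n)
first {zero}  p = nothing
first {suc n} p = if p zero then just zero else Data.Maybe.map suc (first (p ∘ suc))

first-holds : ∀ {n} (p : Fin n → Bool) {y} → first p ≡ just y → p y ≡ true
first-holds {suc n} p {y} h with p zero in p0
first-holds {suc n} p refl | true = p0
... | false with first (p ∘ suc) in e
first-holds {suc n} p refl | false | just y = first-holds (p ∘ suc) e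

first-exists : ∀ {n} (p : Fin n → Bool) y → p y ≡ true → ∃ λ y′ → first p ≡ just y′
first-exists {suc n} p y py with p zero in p0
... | true = zero , refl
first-exists {suc n} p zero    py | false = ⊥-elim (true≢false py p0)
first-exists {suc n} p (suc y) py | false with first-exists (p ∘ suc) y py
... | y′ , e rewrite e = suc y′ , refl

module Reachability {n} (B : Arcs n) (s : Fin n) where

  within : ℕ → Fin n → Bool
  within zero    x = ⌊ x ≟ s ⌋
  within (suc k) x = within k x ∨ any (λ y → within k y ∧ B y x) (allFin n)

  within-suc : ∀ k x → within k x ≡ true → within (suc k) x ≡ true
  within-suc k x h = ∨-introˡ _ h

  within-mono : ∀ {k k′} x → k ℕ.≤ k′ → within k x ≡ true → within k′ x ≡ true
  within-mono {k} x k≤k′ h = go (ℕₚ.≤⇒≤′ k≤k′)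
    where
    go : ∀ {l} → k ℕ.≤′ l → within l x ≡ true
    go ℕ.≤′-refl           = h
    go (ℕ.≤′-step {l} k≤l) = within-suc l x (go k≤l)

  within-step : ∀ k y x → within k y ≡ true → B y x ≡ true → within (suc k) x ≡ true
  within-step k y x hy e = ∨-introʳ (within k x) (any-allFin⁺ (λ y → within k y ∧ B y x) y (∧-intro hy e))

  within-sound : ∀ k x → within k x ≡ true → Reach B s x
  within-sound zero    x h rewrite ≟-true h = here
  within-sound (suc k) x h with ∨-elim {within k x} h
  ... | inj₁ h′ = within-sound k x h′
  ... | inj₂ h′ with any⁻ (λ y → within k y ∧ B y x) {allFin n} h′
  ...   | y , hy = reach-snoc (within-sound k y (∧-conicalˡ _ _ hy)) (∧-conicalʳ (within k y) _ hy)

  reach⇒within : ∀ {z w} → Reach B z w → ∀ k → within k z ≡ true → ∃ λ l → within l w ≡ true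
  reach⇒within here                 k h = k , h
  reach⇒within (step {y = y} e r) k h = reach⇒within r (suc k) (within-step k _ y h e)

  Stable : ℕ → Set
  Stable k = ∀ x → within (suc k) x ≡ within k x

  stable-forever : ∀ {k} → Stable k → ∀ d x → within (d ℕ.+ k) x ≡ within k x
  stable-forever         st zero    x = refl
  stable-forever {k} st (suc d) x = trans (cong₂ _∨_ (stable-forever st d x) (any-cong (allFin n))) (st x)
    where
    any-cong : ∀ ys → any (λ y → within (d ℕ.+ k) y ∧ B y x) ys ≡ any (λ y → within k y ∧ B y x) ys
    any-cong []       = refl
    any-cong (y ∷ ys) = cong₂ _∨_ (cong (_∧ B y x) (stable-forever st d y)) (any-cong ys)

  -- Each level that is not stable has gained a vertex, so some level up to n is stable.
  stable-or-growing : ∀ k → (∃ λ k′ → k′ ℕ.≤ k × Stable k′) ⊎ (suc k ℕ.≤ count (within k))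
  stable-or-growing zero = inj₂ (count-pos (within zero) s (≟-refl s))
  stable-or-growing (suc k) with stable-or-growing k
  ... | inj₁ (k′ , k′≤k , st) = inj₁ (k′ , ℕₚ.m≤n⇒m≤1+n k′≤k , st)
  ... | inj₂ grown with any (λ x → within (suc k) x ∧ not (within k x)) (allFin n) in new
  ...   | false = inj₁ (k , ℕₚ.n≤1+n k , stable)
    where
    stable : Stable k
    stable x with bool-cases (within (suc k) x) | bool-cases (within k x)
    ... | inj₁ now | inj₁ before = trans now (sym before)
    ... | inj₂ now | inj₂ before = trans now (sym before)
    ... | inj₂ now | inj₁ before = ⊥-elim (true≢false (within-suc k x before) now)
    ... | inj₁ now | inj₂ before = ⊥-elim (true≢false (any-allFin⁺ _ x (∧-intro now (not-false before))) new)
  ...   | true with any⁻ (λ x → within (suc k) x ∧ not (within k x)) {allFin n} new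
  ...     | x , hx = inj₂ (ℕₚ.≤-trans (s≤s grown)
                     (count-mono-< (within-suc k) x (not-true (∧-conicalʳ (within (suc k) x) _ hx)) (∧-conicalˡ _ _ hx)))

  stable-level : ∃ λ k → k ℕ.≤ n × Stable k
  stable-level with stable-or-growing n
  ... | inj₁ found = found
  ... | inj₂ n<count = ⊥-elim (ℕₚ.<-irrefl refl (ℕₚ.≤-trans n<count (count≤n (within n))))

  reachable : Fin n → Bool
  reachable = within n

  within⇒reachable : ∀ l x → within l x ≡ true → reachable x ≡ true
  within⇒reachable l x h with stable-level | ℕₚ.≤-total l n
  ... | _ , _ , _ | inj₁ l≤n = within-mono x l≤n h
  ... | k , k≤n , st | inj₂ n≤l = begin
    within n x                  ≡⟨ cong (λ m → within m x) (ℕₚ.m∸n+n≡m k≤n) ⟨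
    within (n ∸ k ℕ.+ k) x      ≡⟨ stable-forever st (n ∸ k) x ⟩
    within k x                  ≡⟨ stable-forever st (l ∸ k) x ⟨
    within (l ∸ k ℕ.+ k) x      ≡⟨ cong (λ m → within m x) (ℕₚ.m∸n+n≡m (ℕₚ.≤-trans k≤n n≤l)) ⟩
    within l x                  ≡⟨ h ⟩
    true                        ∎
    where open ≡-Reasoning

  reachable-complete : ∀ x → Reach B s x → reachable x ≡ true
  reachable-complete x r with reach⇒within r 0 (≟-refl s)
  ... | l , h = within⇒reachable l x h

  reachable-sound : ∀ x → reachable x ≡ true → Reach B s x
  reachable-sound = within-sound n

  reachable-closed : ∀ y x → reachable y ≡ true → B y x ≡ true → reachable x ≡ true
  reachable-closed y x hy e = reachable-complete x (reach-snoc (reachable-sound y hy) e)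

  reachable-source : reachable s ≡ true
  reachable-source = reachable-complete s here

  dist : Fin n → ℕ
  dist x = least (λ k → within k x) n

  within-dist : ∀ x → reachable x ≡ true → within (dist x) x ≡ true
  within-dist x h = least-holds (λ k → within k x) n n ℕₚ.≤-refl h

  dist≡0⇒source : ∀ x → reachable x ≡ true → dist x ≡ 0 → x ≡ s
  dist≡0⇒source x h d≡0 = ≟-true (subst (λ k → within k x ≡ true) d≡0 (within-dist x h))

  bfsParent : Fin n → Maybe (Fin n)
  bfsParent x = first (λ y → within (ℕ.pred (dist x)) y ∧ B y x)

  bfsParent-spec : ∀ x → reachable x ≡ true → x ≢ s →
    ∃ λ y → bfsParent x ≡ just y × B y x ≡ true × reachable y ≡ true × dist y < dist x
  bfsParent-spec x h x≢s with dist x in d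
  ... | zero  = ⊥-elim (x≢s (dist≡0⇒source x h d))
  ... | suc k with any⁻ (λ y → within k y ∧ B y x) {allFin n} entered
    where
    entered : any (λ y → within k y ∧ B y x) (allFin n) ≡ true
    entered with ∨-elim {within k x} (subst (λ m → within m x ≡ true) d (within-dist x h))
    ... | inj₂ e = e
    ... | inj₁ e = ⊥-elim (true≢false e (below-least (λ m → within m x) n k (subst (k <_) (sym d) (ℕₚ.n<1+n k))))
  ...   | y₀ , hy₀ with first-exists (λ y → within k y ∧ B y x) y₀ hy₀
  ...     | y , e with first-holds (λ y → within k y ∧ B y x) e
  ...       | hy = y , e , ∧-conicalʳ (within k y) _ hy , within⇒reachable k y (∧-conicalˡ _ _ hy) ,
                  s≤s (least-minimal (λ m → within m y) n k (∧-conicalˡ _ _ hy))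

module Regraft {n} (B : Arcs n) (s : Fin n) (F₀ : Par n) (rp : Maybe (Fin n)) where

  open Reachability B s public

  regraftedParent : Fin n → Maybe (Fin n)
  regraftedParent x = if reachable x then (if ⌊ x ≟ s ⌋ then rp else bfsParent x) else lookup F₀ x

  regrafted : Par n
  regrafted = Vec.tabulate regraftedParent

  private
    G = regrafted

  regrafted-outside : ∀ x → reachable x ≡ false → lookup G x ≡ lookup F₀ x
  regrafted-outside x h rewrite Vecₚ.lookup∘tabulate regraftedParent x | h = refl

  regrafted-source : lookup G s ≡ rp
  regrafted-source rewrite Vecₚ.lookup∘tabulate regraftedParent s | reachable-source | ≟-refl s = refl

  regrafted-inside : ∀ x → reachable x ≡ true → x ≢ s →
    ∃ λ y → lookup G x ≡ just y × B y x ≡ true × reachable y ≡ true × dist y < dist x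
  regrafted-inside x h x≢s rewrite Vecₚ.lookup∘tabulate regraftedParent x | h | ≟-false x≢s =
    bfsParent-spec x h x≢s

  regrafted-keeps-parents : ∀ x → x ≢ s → hasParent F₀ x ≡ true → hasParent G x ≡ true
  regrafted-keeps-parents x x≢s h with bool-cases (reachable x)
  ... | inj₂ hx rewrite regrafted-outside x hx = h
  ... | inj₁ hx with regrafted-inside x hx x≢s
  ...   | _ , e , _ rewrite e = refl

  regrafted-has-parent : ∀ x → reachable x ≡ true → x ≢ s → hasParent G x ≡ true
  regrafted-has-parent x hx x≢s with regrafted-inside x hx x≢s
  ... | _ , e , _ rewrite e = refl

  module _ (F₀-forest : IsForest B F₀)
           (rp-valid : ∀ {a} → rp ≡ just a → reachable a ≡ false × B a s ≡ true) where

    source-parent : ∀ {p} → lookup G s ≡ just p → reachable p ≡ false × B p s ≡ true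
    source-parent e = rp-valid (trans (sym regrafted-source) e)

    parent-outside : ∀ x p → reachable x ≡ false → lookup F₀ x ≡ just p → reachable p ≡ false
    parent-outside x p hx e with bool-cases (reachable p)
    ... | inj₂ hp = hp
    ... | inj₁ hp = ⊥-elim (true≢false (reachable-closed p x hp (subgraph F₀-forest x p e)) hx)

    climb-outside : ∀ {t u w} → reachable u ≡ false → Climb G t u w → reachable w ≡ false × Climb F₀ t u w
    climb-outside hu stay = hu , stay
    climb-outside {u = u} hu (up {p = p} e c) with trans (sym (regrafted-outside u hu)) e
    ... | e₀ with climb-outside (parent-outside u p hu e₀) c
    ...   | hw , c₀ = hw , up e₀ c₀

    climb-inside : ∀ {t u w} → reachable u ≡ true → Climb G t u w → reachable w ≡ true → dist w ℕ.≤ dist u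
    climb-inside hu stay hw = ℕₚ.≤-refl
    climb-inside {u = u} hu (up e c) hw with u ≟ s
    ... | yes refl = ⊥-elim (true≢false hw (proj₁ (climb-outside (proj₁ (source-parent e)) c)))
    ... | no u≢s with regrafted-inside u hu u≢s
    ...   | y , e′ , _ , hy , y<u with trans (sym e) e′
    ...     | refl = ℕₚ.≤-trans (climb-inside hy c hw) (ℕₚ.<⇒≤ y<u)

    regrafted-subgraph : SubgraphOf B G
    regrafted-subgraph x p e with bool-cases (reachable x)
    ... | inj₂ hx = subgraph F₀-forest x p (trans (sym (regrafted-outside x hx)) e)
    ... | inj₁ hx with x ≟ s
    ...   | yes refl = proj₂ (source-parent e)
    ...   | no x≢s with regrafted-inside x hx x≢s
    ...     | y , e′ , b , _ with trans (sym e) e′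
    ...       | refl = b

    regrafted-acyclic : Acyclic G
    regrafted-acyclic {i = x} t≤n cycle@(up e c) with bool-cases (reachable x)
    ... | inj₂ hx = acyclic F₀-forest t≤n (proj₂ (climb-outside hx cycle))
    ... | inj₁ hx with x ≟ s
    ...   | yes refl = true≢false hx (proj₁ (climb-outside (proj₁ (source-parent e)) c))
    ...   | no x≢s with regrafted-inside x hx x≢s
    ...     | y , e′ , _ , hy , y<x with trans (sym e) e′
    ...       | refl = ℕₚ.<-irrefl refl (ℕₚ.<-≤-trans y<x (climb-inside hy c hx))

    regrafted-forest : IsForest B G
    regrafted-forest = mkForest regrafted-subgraph regrafted-acyclic

    regrafted-tree : rp ≡ nothing → ∀ x → reachable x ≡ true → inTree G s x ≡ true
    regrafted-tree rp≡nothing x hx = root⇒inTree regrafted-acyclic (trans regrafted-source rp≡nothing)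
                                                 (proj₂ (climb-to-source (dist x) x ℕₚ.≤-refl hx))
      where
      climb-to-source : ∀ k u → dist u ℕ.≤ k → reachable u ≡ true → ∃ λ t → Climb G t u s
      climb-to-source k u d≤k hu with u ≟ s
      ... | yes refl = 0 , stay
      ... | no u≢s with regrafted-inside u hu u≢s | k
      ...   | y , e , _ , hy , y<u | zero  = ⊥-elim (ℕₚ.n≮0 (ℕₚ.<-≤-trans y<u d≤k))
      ...   | y , e , _ , hy , y<u | suc k′ with climb-to-source k′ y (ℕₚ.≤-pred (ℕₚ.≤-trans y<u d≤k)) hy
      ...     | t , c = suc t , up e c

∈-allPar : ∀ {n} (P : Par n) → P ∈ allPar n
∈-allPar {n} P = ∈-allVecs n P option∈
  where
  option∈ : ∀ i → lookup P i ∈ (nothing ∷ List.map just (allFin n))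
  option∈ i with lookup P i
  ... | nothing = here refl
  ... | just j  = there (∈-map⁺ just (∈-allFin j))

  ∈-allVecs : ∀ {X : Set} {xs : List X} m (v : Vec X m) → (∀ i → lookup v i ∈ xs) → v ∈ allVecs m xs
  ∈-allVecs         zero    []      _  = here refl
  ∈-allVecs {xs = xs} (suc m) (x ∷ v) v∈ =
    ∈-concatMap⁺ (λ y → List.map (y ∷_) (allVecs m xs))
                 (Any.map (λ { refl → ∈-map⁺ (x ∷_) (∈-allVecs m v (v∈ ∘ suc)) }) (v∈ zero))

module _ {X : Set} (S : X → Bool) (g : X → ℕ) where

  private
    maxOf : List X → ℕ
    maxOf xs = foldr (λ y r → g y ℕ.⊔ r) 0 (filterᵇ S xs)

  maxOf-upper : ∀ {xs x} → x ∈ xs → S x ≡ true → g x ℕ.≤ maxOf xs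
  maxOf-upper {y ∷ xs} (here refl) Sx rewrite Sx = ℕₚ.m≤m⊔n (g y) _
  maxOf-upper {y ∷ xs} (there x∈) Sx with S y
  ... | true  = ℕₚ.≤-trans (maxOf-upper x∈ Sx) (ℕₚ.m≤n⊔m (g y) _)
  ... | false = maxOf-upper x∈ Sx

  maxOf-attained : ∀ xs → maxOf xs ≡ 0 ⊎ ∃ λ x → S x ≡ true × maxOf xs ≡ g x
  maxOf-attained []       = inj₁ refl
  maxOf-attained (y ∷ xs) with S y in Sy
  ... | false = maxOf-attained xs
  ... | true with ℕₚ.⊔-sel (g y) (maxOf xs)
  ...   | inj₁ at-y = inj₂ (y , Sy , at-y)
  ...   | inj₂ at-rest with maxOf-attained xs
  ...     | inj₁ zero′          = inj₁ (trans at-rest zero′)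
  ...     | inj₂ (x , Sx , at-x) = inj₂ (x , Sx , trans at-rest at-x)

emptyPar : ∀ {n} → Par n
emptyPar {n} = Vec.replicate n nothing

lookup-emptyPar : ∀ {n} (i : Fin n) → lookup (emptyPar {n}) i ≡ nothing
lookup-emptyPar {n} i = Vecₚ.lookup-replicate i nothing

emptyPar-forest : ∀ {n} (A : Arcs n) → IsForest A emptyPar
emptyPar-forest A = mkForest (λ i j e → ⊥-elim (nothing≢just (trans (sym (lookup-emptyPar i)) e)))
                             (λ { _ (up e _) → nothing≢just (trans (sym (lookup-emptyPar _)) e) })
  where
  nothing≢just : ∀ {n} {j : Fin n} → nothing ≢ just j
  nothing≢just ()

nArcs-emptyPar : ∀ {n} → nArcs (emptyPar {n}) ≡ 0
nArcs-emptyPar {n} = trans (nArcs≡count (emptyPar {n})) (count-zero _ (λ i → cong is-just (lookup-emptyPar {n} i)))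

module _ {n} (A : Arcs n) where

  maxArcs-upper : ∀ P → IsForest A P → nArcs P ℕ.≤ maxArcs A
  maxArcs-upper P f = maxOf-upper (isForest A) nArcs (∈-allPar P) (IsForest⇒isForest f)

  maxArcs-attained : ∃ λ P → IsForest A P × nArcs P ≡ maxArcs A
  maxArcs-attained with maxOf-attained (isForest A) nArcs (allPar n)
  ... | inj₁ max≡0 = emptyPar , emptyPar-forest A , trans (nArcs-emptyPar {n}) (sym max≡0)
  ... | inj₂ (P , h , e) = P , isForest⇒IsForest h , sym e

  n∸forestDim≡maxArcs : n ∸ forestDim A ≡ maxArcs A
  n∸forestDim≡maxArcs with maxArcs-attained
  ... | P , _ , e = ℕₚ.m∸[m∸n]≡n (subst (ℕ._≤ n) e (subst (ℕ._≤ n) (sym (nArcs≡count P)) (count≤n _)))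

record IsMaximum {n} (A : Arcs n) (P : Par n) : Set where
  constructor mkMaximum
  field
    forest  : IsForest A P
    maximal : nArcs P ≡ maxArcs A
open IsMaximum public

module _ {n} {A : Arcs n} where

  maximum-exists : ∃ (IsMaximum A)
  maximum-exists with maxArcs-attained A
  ... | P , f , e = P , mkMaximum f e

  counted⇒IsMaximum : ∀ {k P} → k ≡ maxArcs A → (isForest A P ∧ (nArcs P ℕ.≡ᵇ k)) ≡ true → IsMaximum A P
  counted⇒IsMaximum {k} {P} k≡max h = mkMaximum (isForest⇒IsForest (∧-conicalˡ _ _ h))
    (trans (ℕₚ.≡ᵇ⇒≡ _ _ (Equivalence.from T-≡ (∧-conicalʳ (isForest A P) _ h))) k≡max)

  IsMaximum⇒counted : ∀ {k P} → k ≡ maxArcs A → IsMaximum A P → (isForest A P ∧ (nArcs P ℕ.≡ᵇ k)) ≡ true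
  IsMaximum⇒counted k≡max (mkMaximum f e) rewrite IsForest⇒isForest f =
    Equivalence.to T-≡ (ℕₚ.≡⇒≡ᵇ _ _ (trans e (sym k≡max)))

  𝓕⇒IsMaximum : ∀ {P} → 𝓕 A (n ∸ forestDim A) P ≡ true → IsMaximum A P
  𝓕⇒IsMaximum = counted⇒IsMaximum (n∸forestDim≡maxArcs A)

  IsMaximum⇒𝓕 : ∀ {P} → IsMaximum A P → 𝓕 A (n ∸ forestDim A) P ≡ true
  IsMaximum⇒𝓕 = IsMaximum⇒counted (n∸forestDim≡maxArcs A)

  maximum-of-≥ : ∀ {P} → IsForest A P → maxArcs A ℕ.≤ nArcs P → IsMaximum A P
  maximum-of-≥ {P} f ≥max = mkMaximum f (ℕₚ.≤-antisym (maxArcs-upper A P f) ≥max)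

module _ {n} (A : Arcs n) where

  open Reachability using (reachable; reachable-sound; reachable-complete; reachable-source)

  knotOf : Fin n → VSet n
  knotOf r = Vec.tabulate λ x → reachable A r x ∧ reachable A x r

  ∈-knotOf : ∀ r x → (x ∈ᵇ knotOf r) ≡ (reachable A r x ∧ reachable A x r)
  ∈-knotOf r x = Vecₚ.lookup∘tabulate (λ x → reachable A r x ∧ reachable A x r) x

  -- If an arc a → b entered the knot of a root r from outside, regrafting the vertices reachable
  -- from b below a would give every vertex that had a parent one, and r one more.
  maximum-root-in-knot : ∀ {F} → IsMaximum A F → ∀ r → lookup F r ≡ nothing → InKtilde A r
  maximum-root-in-knot {F} F-max r r-root =
    knotOf r , record { nonempty = r , r∈ ; mutual-reach = reach-mutual ; no-entering = closed } , r∈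
    where
    r∈ : (r ∈ᵇ knotOf r) ≡ true
    r∈ rewrite ∈-knotOf r r | reachable-source A r = refl

    reach-mutual : ∀ a b → (a ∈ᵇ knotOf r) ≡ true → (b ∈ᵇ knotOf r) ≡ true → Reach A a b
    reach-mutual a b ha hb rewrite ∈-knotOf r a | ∈-knotOf r b =
      reach-trans (reachable-sound A a r (∧-conicalʳ (reachable A r a) _ ha))
                  (reachable-sound A r b (∧-conicalˡ _ _ hb))

    closed : ∀ a b → A a b ≡ true → (b ∈ᵇ knotOf r) ≡ true → (a ∈ᵇ knotOf r) ≡ true
    closed a b ab hb rewrite ∈-knotOf r a | ∈-knotOf r b with bool-cases (reachable A r a)
    ... | inj₁ ra rewrite ra = reachable-complete A a r (step ab (reachable-sound A b r (∧-conicalʳ (reachable A r b) _ hb)))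
    ... | inj₂ ra = ⊥-elim (ℕₚ.<-irrefl refl (ℕₚ.<-≤-trans more-arcs (maxArcs-upper A G G-forest)))
      where
      rb : Reach A r b
      rb = reachable-sound A r b (∧-conicalˡ _ _ hb)

      b↛a : reachable A b a ≡ false
      b↛a with bool-cases (reachable A b a)
      ... | inj₂ f = f
      ... | inj₁ t = ⊥-elim (true≢false (reachable-complete A r a (reach-trans rb (reachable-sound A b a t))) ra)

      open Regraft A b F (just a)
        using (regrafted; regrafted-source; regrafted-keeps-parents; regrafted-has-parent; regrafted-forest)

      gains : ∀ x → hasParent F x ≡ true → hasParent regrafted x ≡ true
      gains x h with x ≟ b
      ... | yes refl rewrite regrafted-source = refl
      ... | no x≢b = regrafted-keeps-parents x x≢b h

      r-gains : hasParent regrafted r ≡ true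
      r-gains with r ≟ b
      ... | yes refl rewrite regrafted-source = refl
      ... | no r≢b = regrafted-has-parent r (∧-conicalʳ (reachable A r b) _ hb) r≢b

      G = regrafted

      G-forest : IsForest A G
      G-forest = regrafted-forest (forest F-max) λ { refl → b↛a , ab }

      more-arcs : maxArcs A < nArcs G
      more-arcs = subst₂ _<_ (trans (sym (nArcs≡count F)) (maximal F-max)) (sym (nArcs≡count G))
                    (count-mono-< gains r (cong is-just r-root) r-gains)

  climb-in-knot : ∀ {K′} → UndomKnot A K′ → ∀ {P} → SubgraphOf A P → ∀ {t u w} → Climb P t u w →
                  (u ∈ᵇ K′) ≡ true → (w ∈ᵇ K′) ≡ true
  climb-in-knot knot sub stay     hu = hu
  climb-in-knot knot sub (up e c) hu = climb-in-knot knot sub c (UndomKnot.no-entering knot _ _ (sub _ _ e) hu)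

  -- Regrafting everything reachable from j below j loses at most j's own parent, while the root of
  -- j's old tree, which lies in j's knot, gains one.
  maximum-through : ∀ {K′} → UndomKnot A K′ → ∀ j → (j ∈ᵇ K′) ≡ true → ∀ i → Reach A j i →
                    ∃ λ G → IsMaximum A G × inTree G j i ≡ true
  maximum-through {K′} knot j hj i j⇝i =
    G , maximum-of-≥ G-forest enough-arcs , regrafted-tree (forest F₀-max) (λ ()) refl i (reachable-complete A j i j⇝i)
    where
    F₀ = proj₁ (maximum-exists {A = A})
    F₀-max = proj₂ (maximum-exists {A = A})
    open Regraft A j F₀ nothing
      using (regrafted; regrafted-source; regrafted-keeps-parents; regrafted-has-parent; regrafted-forest; regrafted-tree)
    G = regrafted

    G-forest : IsForest A G
    G-forest = regrafted-forest (forest F₀-max) (λ ())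

    old-root = climb-to-root (acyclic (forest F₀-max)) j
    r = proj₁ old-root

    r∈K′ : (r ∈ᵇ K′) ≡ true
    r∈K′ = climb-in-knot knot (subgraph (forest F₀-max)) (proj₂ (proj₂ (proj₂ old-root))) hj

    counts : count (hasParent F₀) ℕ.≤ count (hasParent G)
    counts with r ≟ j
    ... | yes r≡j = count-mono λ x h → regrafted-keeps-parents x (λ x≡j → true≢false h (root-has-none x≡j r≡j)) h
      where
      root-has-none : ∀ {x} → x ≡ j → r ≡ j → hasParent F₀ x ≡ false
      root-has-none x≡j r≡j = trans (cong (hasParent F₀) (trans x≡j (sym r≡j))) (cong is-just (proj₁ (proj₂ old-root)))
    ... | no r≢j = count-exchange (hasParent F₀) (hasParent G) j r r≢j regrafted-keeps-parents
                     (cong is-just (proj₁ (proj₂ old-root)))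
                     (regrafted-has-parent r (reachable-complete A j r (UndomKnot.mutual-reach knot j r hj r∈K′)) r≢j)

    enough-arcs : maxArcs A ℕ.≤ nArcs G
    enough-arcs = subst₂ ℕ._≤_ (trans (sym (nArcs≡count F₀)) (maximal F₀-max)) (sym (nArcs≡count G)) counts

arcWeight : ∀ {n} → Weights n → Fin n → Maybe (Fin n) → ℚ
arcWeight ε i nothing  = 1ℚ
arcWeight ε i (just j) = ε j i

-- `wt` multiplies factors computed by a helper local to its definition; naming its step function
-- lets that helper be evaluated by abstracting over `lookup P i`.
wt-step : ∀ {n} (ε : Weights n) (P : Par n) → Σ (Fin n → ℚ → ℚ) λ step → wt ε P ≡ foldr step 1ℚ (allFin n)
wt-step ε P = _ , refl

wt-step-factor : ∀ {n} (ε : Weights n) (P : Par n) i r → proj₁ (wt-step ε P) i r ≡ arcWeight ε i (lookup P i) * r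
wt-step-factor ε P i r with lookup P i
... | nothing = refl
... | just j  = refl

wt≡∏ : ∀ {n} (ε : Weights n) (P : Par n) → wt ε P ≡ ∏ (λ i → arcWeight ε i (lookup P i))
wt≡∏ {n} ε P = trans (proj₂ (wt-step ε P)) (go n id)
  where
  go : ∀ m (g : Fin m → Fin n) →
       foldr (proj₁ (wt-step ε P)) 1ℚ (List.tabulate g) ≡ ∏ (λ i → arcWeight ε (g i) (lookup P (g i)))
  go zero    g = refl
  go (suc m) g = trans (wt-step-factor ε P (g zero) _) (cong (arcWeight ε (g zero) (lookup P (g zero)) *_) (go m (g ∘ suc)))

wt-inside-outside : ∀ {n} (ε : Weights n) (K : VSet n) (F : Par n) →
                    wt ε F ≡ wt ε (inside K F) * wt ε (outside K F)
wt-inside-outside ε K F = begin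
  wt ε F                                ≡⟨ wt≡∏ ε F ⟩
  ∏ (factor F)                          ≡⟨ ∏-cong split ⟩
  ∏ (λ i → factor (inside K F) i * factor (outside K F) i)
                                        ≡⟨ ∏-distrib-* (factor (inside K F)) (factor (outside K F)) ⟩
  ∏ (factor (inside K F)) * ∏ (factor (outside K F))
                                        ≡⟨ cong₂ _*_ (wt≡∏ ε (inside K F)) (wt≡∏ ε (outside K F)) ⟨
  wt ε (inside K F) * wt ε (outside K F) ∎
  where
  open ≡-Reasoning
  factor : Par _ → Fin _ → ℚ
  factor P i = arcWeight ε i (lookup P i)
  split : ∀ i → factor F i ≡ factor (inside K F) i * factor (outside K F) i
  split i rewrite lookup-inside K F i | lookup-outside K F i with lookup K i
  ... | true  = sym (ℚₚ.*-identityʳ _)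
  ... | false = sym (ℚₚ.*-identityˡ _)

wt-pos : ∀ {n} (ε : Weights n) (F : Par n) → (∀ i j → lookup F i ≡ just j → 0ℚ <ℚ ε j i) → 0ℚ <ℚ wt ε F
wt-pos ε F pos = subst (0ℚ <ℚ_) (sym (wt≡∏ ε F)) (∏-pos _ factor-pos)
  where
  factor-pos : ∀ i → 0ℚ <ℚ arcWeight ε i (lookup F i)
  factor-pos i with lookup F i in e
  ... | nothing = ℚₚ.positive⁻¹ 1ℚ
  ... | just j  = pos i j e

module _ {n} (ε : Weights n) where

  wset≡∑ : ∀ S → wset ε S ≡ ∑ₗ (allPar n) (select S (wt ε))
  wset≡∑ S = ∑ₗ-filter (allPar n) S (wt ε)

  wset-cong : ∀ {S S′} → (∀ P → S P ≡ S′ P) → wset ε S ≡ wset ε S′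
  wset-cong {S} {S′} S≗S′ = begin
    wset ε S                          ≡⟨ wset≡∑ S ⟩
    ∑ₗ (allPar n) (select S (wt ε))   ≡⟨ ∑ₗ-cong (allPar n) (λ P → cong (λ b → if b then wt ε P else 0ℚ) (S≗S′ P)) ⟩
    ∑ₗ (allPar n) (select S′ (wt ε))  ≡⟨ wset≡∑ S′ ⟨
    wset ε S′                         ∎
    where open ≡-Reasoning

  wset-empty : ∀ S → (∀ P → S P ≡ false) → wset ε S ≡ 0ℚ
  wset-empty S none = trans (wset≡∑ S) (∑ₗ-zero (allPar n) _ (λ P → cong (λ b → if b then wt ε P else 0ℚ) (none P)))

  private
    select-nonneg : ∀ S → (∀ P → S P ≡ true → 0ℚ ≤ wt ε P) → ∀ P → 0ℚ ≤ select S (wt ε) P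
    select-nonneg S nonneg P with S P in SP
    ... | true  = nonneg P SP
    ... | false = ℚₚ.≤-refl

  wset-nonneg : ∀ S → (∀ P → S P ≡ true → 0ℚ ≤ wt ε P) → 0ℚ ≤ wset ε S
  wset-nonneg S nonneg = subst (0ℚ ≤_) (sym (wset≡∑ S)) (∑ₗ-nonneg (allPar n) _ (select-nonneg S nonneg))

  wset-pos : ∀ S → (∀ P → S P ≡ true → 0ℚ ≤ wt ε P) → ∀ P₀ → S P₀ ≡ true → 0ℚ <ℚ wt ε P₀ → 0ℚ <ℚ wset ε S
  wset-pos S nonneg P₀ SP₀ pos = subst (0ℚ <ℚ_) (sym (wset≡∑ S))
    (∑ₗ-pos (allPar n) _ (select-nonneg S nonneg) (∈-allPar P₀) (subst (λ b → 0ℚ <ℚ (if b then wt ε P₀ else 0ℚ)) (sym SP₀) pos))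

  wset-≢0 : ∀ S → wset ε S ≢ 0ℚ → ∃ λ P → S P ≡ true
  wset-≢0 S ≢0 = ∑ₗ-select-≢0 (allPar n) S (wt ε) (≢0 ∘ trans (wset≡∑ S))

  wset-partition : ∀ S (part : Fin n → Par n → Bool) →
    (∀ k P → part k P ≡ true → S P ≡ true) →
    (∀ P → S P ≡ true → ∃ λ k → part k P ≡ true × ∀ k′ → part k′ P ≡ true → k′ ≡ k) →
    sum (λ k → wset ε (part k)) ≡ wset ε S
  wset-partition S part part⇒S S⇒part = begin
    sum (λ k → wset ε (part k))                               ≡⟨ sum-cong-≗ (λ k → wset≡∑ (part k)) ⟩
    sum (λ k → ∑ₗ (allPar n) (select (part k) (wt ε)))        ≡⟨ ∑ₗ-sum (allPar n) (λ P k → select (part k) (wt ε) P) ⟨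
    ∑ₗ (allPar n) (λ P → sum (λ k → select (part k) (wt ε) P)) ≡⟨ ∑ₗ-cong (allPar n) one-part ⟩
    ∑ₗ (allPar n) (select S (wt ε))                           ≡⟨ wset≡∑ S ⟨
    wset ε S                                                  ∎
    where
    open ≡-Reasoning
    one-part : ∀ P → sum (λ k → select (part k) (wt ε) P) ≡ select S (wt ε) P
    one-part P with S P in SP
    ... | true with S⇒part P SP
    ...   | k , pk , unique = trans (sum-single _ k off) (cong (λ b → if b then wt ε P else 0ℚ) pk)
      where
      off : ∀ k′ → k′ ≢ k → select (part k′) (wt ε) P ≡ 0ℚ
      off k′ k′≢k with part k′ P in pk′
      ... | true  = ⊥-elim (k′≢k (unique k′ pk′))
      ... | false = refl
    one-part P | false = sum-zero _ none
      where
      none : ∀ k → select (part k) (wt ε) P ≡ 0ℚ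
      none k with part k P in pk
      ... | true  = ⊥-elim (true≢false (part⇒S k P pk) SP)
      ... | false = refl

  wset-product : ∀ (K : VSet n) S S₁ S₂ → (∀ F → S F ≡ S₁ (inside K F) ∧ S₂ (outside K F)) →
    (∀ T → S₁ T ≡ true → supportedIn K T ≡ true) → (∀ P → S₂ P ≡ true → supportedIn (Vec.map not K) P ≡ true) →
    wset ε S ≡ wset ε S₁ * wset ε S₂
  wset-product K S S₁ S₂ S≡ supp₁ supp₂ = begin
    wset ε S                                                 ≡⟨ wset≡∑ S ⟩
    ∑ₗ (allPar n) (select S (wt ε))                          ≡⟨ ∑ₗ-cong (allPar n) factor ⟩
    ∑ₗ (allPar n) (λ F → a (inside K F) * b (outside K F))   ≡⟨ ∑-inside-outside (allFin n) n K a b ⟩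
    ∑ₗ (allPar n) (select (supportedIn K) a) * ∑ₗ (allPar n) (select (supportedIn (Vec.map not K)) b)
                                                             ≡⟨ cong₂ _*_ (∑ₗ-cong (allPar n) (supported S₁ K supp₁))
                                                                          (∑ₗ-cong (allPar n) (supported S₂ (Vec.map not K) supp₂)) ⟩
    ∑ₗ (allPar n) a * ∑ₗ (allPar n) b                        ≡⟨ cong₂ _*_ (wset≡∑ S₁) (wset≡∑ S₂) ⟨
    wset ε S₁ * wset ε S₂                                    ∎
    where
    open ≡-Reasoning
    a = select S₁ (wt ε)
    b = select S₂ (wt ε)
    factor : ∀ F → select S (wt ε) F ≡ a (inside K F) * b (outside K F)
    factor F rewrite S≡ F | wt-inside-outside ε K F with S₁ (inside K F) | S₂ (outside K F)
    ... | true  | true  = refl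
    ... | true  | false = sym (ℚₚ.*-zeroʳ (wt ε (inside K F)))
    ... | false | w     = sym (ℚₚ.*-zeroˡ (if w then wt ε (outside K F) else 0ℚ))
    supported : ∀ S′ (L : VSet n) → (∀ P → S′ P ≡ true → supportedIn L P ≡ true) →
                ∀ P → select (supportedIn L) (select S′ (wt ε)) P ≡ select S′ (wt ε) P
    supported S′ L supp P with S′ P in SP
    ... | true rewrite supp P SP = refl
    ... | false with supportedIn L P
    ...   | true  = refl
    ...   | false = refl

module _ {q : ℚ} (q≢0 : q ≢ 0ℚ) where

  private
    q⁻¹ : ℚ
    q⁻¹ = (1/ q) {{≢-nonZero q≢0}}

  /ℚ≡*1/ : ∀ p → p /ℚ q ≡ p * q⁻¹
  /ℚ≡*1/ p with q ≟ℚ 0ℚ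
  ... | yes q≡0 = ⊥-elim (q≢0 q≡0)
  ... | no _    = refl

  *1/-inverse : q * q⁻¹ ≡ 1ℚ
  *1/-inverse = ℚₚ.*-inverseʳ q {{≢-nonZero q≢0}}

  /ℚ-self : q /ℚ q ≡ 1ℚ
  /ℚ-self = trans (/ℚ≡*1/ q) *1/-inverse

  sum-/ℚ : ∀ {m} (f : Fin m → ℚ) → sum (λ k → f k /ℚ q) ≡ sum f /ℚ q
  sum-/ℚ f = trans (sum-cong-≗ (λ k → /ℚ≡*1/ (f k)))
                   (trans (sym (*-distribʳ-sum q⁻¹ f)) (sym (/ℚ≡*1/ (sum f))))

module _ {q : ℚ} (0<q : 0ℚ <ℚ q) where

  private
    q⁻¹-pos : 0ℚ <ℚ (1/ q) {{≢-nonZero (pos⇒≢0 0<q)}}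
    q⁻¹-pos = ℚₚ.positive⁻¹ _ {{ℚₚ.1/pos⇒pos q {{Data.Rational.positive 0<q}}}}

  /ℚ-nonneg : ∀ {p} → 0ℚ ≤ p → 0ℚ ≤ p /ℚ q
  /ℚ-nonneg {p} 0≤p rewrite /ℚ≡*1/ (pos⇒≢0 0<q) p = nonneg*nonneg 0≤p (ℚₚ.<⇒≤ q⁻¹-pos)

  /ℚ-pos : ∀ {p} → 0ℚ <ℚ p → 0ℚ <ℚ p /ℚ q
  /ℚ-pos {p} 0<p rewrite /ℚ≡*1/ (pos⇒≢0 0<q) p = pos*pos 0<p q⁻¹-pos

0/ℚ : ∀ q → 0ℚ /ℚ q ≡ 0ℚ
0/ℚ q with q ≟ℚ 0ℚ
... | yes _   = refl
... | no q≢0  = ℚₚ.*-zeroˡ ((1/ q) {{≢-nonZero q≢0}})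

/ℚ-≢0 : ∀ p q → p /ℚ q ≢ 0ℚ → p ≢ 0ℚ
/ℚ-≢0 p q ≢0 refl = ≢0 (0/ℚ q)

/ℚ-cancelʳ : ∀ a {t p} → 0ℚ <ℚ t → 0ℚ <ℚ p → (a * p) /ℚ (t * p) ≡ a /ℚ t
/ℚ-cancelʳ a {t} {p} 0<t 0<p = begin
  (a * p) /ℚ (t * p)                  ≡⟨ /ℚ≡*1/ tp≢0 (a * p) ⟩
  a * p * x                           ≡⟨ ℚₚ.*-identityʳ _ ⟨
  a * p * x * 1ℚ                      ≡⟨ cong (a * p * x *_) (*1/-inverse t≢0) ⟨
  a * p * x * (t * y)                 ≡⟨ solve 5 (λ a p x t y → a :* p :* x :* (t :* y) := a :* y :* (t :* p :* x)) refl a p x t y ⟩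
  a * y * (t * p * x)                 ≡⟨ cong (a * y *_) (*1/-inverse tp≢0) ⟩
  a * y * 1ℚ                          ≡⟨ ℚₚ.*-identityʳ _ ⟩
  a * y                               ≡⟨ /ℚ≡*1/ t≢0 a ⟨
  a /ℚ t                              ∎
  where
  open ≡-Reasoning
  open +-*-Solver
  t≢0 = pos⇒≢0 0<t
  tp≢0 = pos⇒≢0 (pos*pos 0<t 0<p)
  x = (1/ (t * p)) {{≢-nonZero tp≢0}}
  y = (1/ t) {{≢-nonZero t≢0}}

/ℚ-rescale : ∀ {a} b c {D} → a ≢ 0ℚ → D ≢ 0ℚ → (b * c) /ℚ D ≡ (b /ℚ a) * ((a * c) /ℚ D)
/ℚ-rescale {a} b c {D} a≢0 D≢0 = begin
  (b * c) /ℚ D                        ≡⟨ /ℚ≡*1/ D≢0 (b * c) ⟩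
  b * c * x                           ≡⟨ ℚₚ.*-identityʳ _ ⟨
  b * c * x * 1ℚ                      ≡⟨ cong (b * c * x *_) (*1/-inverse a≢0) ⟨
  b * c * x * (a * y)                 ≡⟨ solve 5 (λ b c x a y → b :* c :* x :* (a :* y) := b :* y :* (a :* c :* x)) refl b c x a y ⟩
  b * y * (a * c * x)                 ≡⟨ cong₂ _*_ (/ℚ≡*1/ a≢0 b) (/ℚ≡*1/ D≢0 (a * c)) ⟨
  (b /ℚ a) * ((a * c) /ℚ D)           ∎
  where
  open ≡-Reasoning
  open +-*-Solver
  x = (1/ D) {{≢-nonZero D≢0}}
  y = (1/ a) {{≢-nonZero a≢0}}

module KnotDecomposition {n} (A : Arcs n) (K : VSet n) (knot : UndomKnot A K) where

  open UndomKnot knot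

  inK : Fin n → Bool
  inK i = i ∈ᵇ K

  ΓK Γ₋K : Arcs n
  ΓK  = inducedArcs A K
  Γ₋K = minusArcs A K

  induced-arc : ∀ {a b} → ΓK a b ≡ true → A a b ≡ true × inK a ≡ true × inK b ≡ true
  induced-arc {a} {b} h = ∧-conicalˡ _ _ h , ∧-conicalˡ _ _ (∧-conicalʳ (A a b) _ h) ,
                          ∧-conicalʳ (inK a) _ (∧-conicalʳ (A a b) _ h)

  induced-arc-intro : ∀ {a b} → A a b ≡ true → inK a ≡ true → inK b ≡ true → ΓK a b ≡ true
  induced-arc-intro ab ha hb = ∧-intro ab (∧-intro ha hb)

  -- Since no arc enters K, the arcs of Γ₋K are exactly the arcs of Γ ending outside K.
  minus-arc : ∀ {a b} → Γ₋K a b ≡ true → A a b ≡ true × inK b ≡ false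
  minus-arc {a} {b} h with bool-cases (inK b)
  ... | inj₂ hb = ∧-conicalˡ _ _ h , hb
  ... | inj₁ hb = ⊥-elim (true≢false (∧-conicalʳ (A a b) _ h)
                                    (cong₂ (λ x y → not (x ∧ y)) (no-entering a b (∧-conicalˡ _ _ h) hb) hb))

  minus-arc-intro : ∀ {a b} → A a b ≡ true → inK b ≡ false → Γ₋K a b ≡ true
  minus-arc-intro {a} {b} ab hb rewrite ab | hb with inK a
  ... | true  = refl
  ... | false = refl

  lookup-inside-∈ : ∀ (P : Par n) i → inK i ≡ true → lookup (inside K P) i ≡ lookup P i
  lookup-inside-∈ P i h rewrite lookup-inside K P i | h = refl

  lookup-inside-∉ : ∀ (P : Par n) i → inK i ≡ false → lookup (inside K P) i ≡ nothing
  lookup-inside-∉ P i h rewrite lookup-inside K P i | h = refl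

  lookup-outside-∈ : ∀ (P : Par n) i → inK i ≡ true → lookup (outside K P) i ≡ nothing
  lookup-outside-∈ P i h rewrite lookup-outside K P i | h = refl

  lookup-outside-∉ : ∀ (P : Par n) i → inK i ≡ false → lookup (outside K P) i ≡ lookup P i
  lookup-outside-∉ P i h rewrite lookup-outside K P i | h = refl

  inside-⊑ : ∀ (P : Par n) → inside K P ⊑ P
  inside-⊑ P i p e with bool-cases (inK i)
  ... | inj₁ h = trans (sym (lookup-inside-∈ P i h)) e
  ... | inj₂ h with trans (sym (lookup-inside-∉ P i h)) e
  ...   | ()

  outside-⊑ : ∀ (P : Par n) → outside K P ⊑ P
  outside-⊑ P i p e with bool-cases (inK i)
  ... | inj₂ h = trans (sym (lookup-outside-∉ P i h)) e
  ... | inj₁ h with trans (sym (lookup-outside-∈ P i h)) e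
  ...   | ()

  inside-forest : ∀ {F} → IsForest A F → IsForest ΓK (inside K F)
  inside-forest {F} f = mkForest sub (acyclic-⊑ (inside-⊑ F) (acyclic f))
    where
    sub : SubgraphOf ΓK (inside K F)
    sub i p e with bool-cases (inK i)
    ... | inj₂ h with trans (sym (lookup-inside-∉ F i h)) e
    ...   | ()
    sub i p e | inj₁ h = induced-arc-intro (subgraph f i p e′) (no-entering p i (subgraph f i p e′) h) h
      where e′ = inside-⊑ F i p e

  outside-forest : ∀ {F} → IsForest A F → IsForest Γ₋K (outside K F)
  outside-forest {F} f = mkForest sub (acyclic-⊑ (outside-⊑ F) (acyclic f))
    where
    sub : SubgraphOf Γ₋K (outside K F)
    sub i p e with bool-cases (inK i)
    ... | inj₁ h with trans (sym (lookup-outside-∈ F i h)) e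
    ...   | ()
    sub i p e | inj₂ h = minus-arc-intro (subgraph f i p (outside-⊑ F i p e)) h

  nArcs-inside-outside : ∀ (F : Par n) → nArcs F ≡ nArcs (inside K F) ℕ.+ nArcs (outside K F)
  nArcs-inside-outside F = begin
    nArcs F                                                      ≡⟨ nArcs≡count F ⟩
    count (hasParent F)                                          ≡⟨ count-split (hasParent F) inK ⟩
    count (λ i → hasParent F i ∧ inK i) ℕ.+ count (λ i → hasParent F i ∧ not (inK i))
                                                                 ≡⟨ cong₂ ℕ._+_ (count-cong in-part) (count-cong out-part) ⟩
    count (hasParent (inside K F)) ℕ.+ count (hasParent (outside K F))
                                                                 ≡⟨ cong₂ ℕ._+_ (nArcs≡count (inside K F)) (nArcs≡count (outside K F)) ⟨
    nArcs (inside K F) ℕ.+ nArcs (outside K F)                   ∎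
    where
    open ≡-Reasoning
    in-part : ∀ i → (hasParent F i ∧ inK i) ≡ hasParent (inside K F) i
    in-part i rewrite lookup-inside K F i with inK i | lookup F i
    ... | true  | _       = ∧-identityʳ _
    ... | false | nothing = refl
    ... | false | just _  = refl
    out-part : ∀ i → (hasParent F i ∧ not (inK i)) ≡ hasParent (outside K F) i
    out-part i rewrite lookup-outside K F i with inK i | lookup F i
    ... | false | _       = ∧-identityʳ _
    ... | true  | nothing = refl
    ... | true  | just _  = refl

  |K| : ℕ
  |K| = count inK

  rootsInK : Par n → ℕ
  rootsInK T = count (λ i → inK i ∧ is-nothing (lookup T i))

  induced-child-in-K : ∀ {T} → IsForest ΓK T → ∀ i → hasParent T i ≡ true → inK i ≡ true
  induced-child-in-K {T} f i h with lookup T i in e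
  ... | just p = proj₂ (proj₂ (induced-arc (subgraph f i p e)))

  induced-root-outside : ∀ {T} → IsForest ΓK T → ∀ i → inK i ≡ false → lookup T i ≡ nothing
  induced-root-outside {T} f i h with lookup T i in e
  ... | nothing = refl
  ... | just p  = ⊥-elim (true≢false (proj₂ (proj₂ (induced-arc (subgraph f i p e)))) h)

  minus-root-inside : ∀ {P} → IsForest Γ₋K P → ∀ i → inK i ≡ true → lookup P i ≡ nothing
  minus-root-inside {P} f i h with lookup P i in e
  ... | nothing = refl
  ... | just p  = ⊥-elim (true≢false h (proj₂ (minus-arc (subgraph f i p e))))

  arcs+roots : ∀ {T} → IsForest ΓK T → nArcs T ℕ.+ rootsInK T ≡ |K|
  arcs+roots {T} f = begin
    nArcs T ℕ.+ rootsInK T                                    ≡⟨ cong (ℕ._+ rootsInK T) (nArcs≡count T) ⟩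
    count (hasParent T) ℕ.+ rootsInK T                        ≡⟨ cong₂ ℕ._+_ (count-cong with-parent) (count-cong roots) ⟩
    count (λ i → inK i ∧ hasParent T i) ℕ.+ count (λ i → inK i ∧ not (hasParent T i))
                                                              ≡⟨ count-split inK (hasParent T) ⟨
    |K|                                                       ∎
    where
    open ≡-Reasoning
    with-parent : ∀ i → hasParent T i ≡ (inK i ∧ hasParent T i)
    with-parent i with bool-cases (hasParent T i)
    ... | inj₁ h rewrite h | induced-child-in-K f i h = refl
    ... | inj₂ h rewrite h = sym (∧-zeroʳ (inK i))
    roots : ∀ i → (inK i ∧ is-nothing (lookup T i)) ≡ (inK i ∧ not (hasParent T i))
    roots i with lookup T i
    ... | nothing = refl
    ... | just _  = refl

  climb-in-K : ∀ {T} → IsForest ΓK T → ∀ {t u w} → Climb T t u w → inK u ≡ true → inK w ≡ true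
  climb-in-K f stay     h = h
  climb-in-K f (up e c) h = climb-in-K f c (proj₁ (proj₂ (induced-arc (subgraph f _ _ e))))

  k₀ : Fin n
  k₀ = proj₁ nonempty

  rootsInK-pos : ∀ {T} → IsForest ΓK T → 1 ℕ.≤ rootsInK T
  rootsInK-pos {T} f with climb-to-root (acyclic f) k₀
  ... | r , er , _ , c = count-pos _ r (∧-intro (climb-in-K f c (proj₂ nonempty)) (cong is-nothing er))

  record SpanningTreeFrom (j : Fin n) (T : Par n) : Set where
    field
      root∈K : inK j ≡ true
      spanning-forest : IsForest ΓK T
      spans  : ∀ x → inK x ≡ true → inTree T j x ≡ true

  𝓣from⇒SpanningTreeFrom : ∀ {j T} → 𝓣from A K j T ≡ true → SpanningTreeFrom j T
  𝓣from⇒SpanningTreeFrom {j} {T} h = record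
    { root∈K = ∧-conicalˡ _ _ h
    ; spanning-forest = isForest⇒IsForest (∧-conicalˡ _ _ (∧-conicalʳ (inK j) _ h))
    ; spans  = spans
    }
    where
    everywhere : ∀ i → (if inK i then inTree T j i else is-nothing (lookup T i)) ≡ true
    everywhere = all-allFin⁻ _ (∧-conicalʳ (isForest ΓK T) _ (∧-conicalʳ (inK j) _ h))
    spans : ∀ x → inK x ≡ true → inTree T j x ≡ true
    spans x hx with everywhere x
    ... | h′ rewrite hx = h′

  SpanningTreeFrom⇒𝓣from : ∀ {j T} → SpanningTreeFrom j T → 𝓣from A K j T ≡ true
  SpanningTreeFrom⇒𝓣from {j} {T} tree
    rewrite SpanningTreeFrom.root∈K tree | IsForest⇒isForest (SpanningTreeFrom.spanning-forest tree) =
    all-allFin⁺ _ everywhere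
    where
    open SpanningTreeFrom tree
    everywhere : ∀ i → (if inK i then inTree T j i else is-nothing (lookup T i)) ≡ true
    everywhere i with bool-cases (inK i)
    ... | inj₁ h rewrite h = spans i h
    ... | inj₂ h rewrite h = cong is-nothing (induced-root-outside spanning-forest i h)

  spanning-tree-roots : ∀ {j T} → SpanningTreeFrom j T → rootsInK T ≡ 1
  spanning-tree-roots {j} {T} tree =
    count-one _ j (∧-intro root∈K (∧-conicalˡ _ _ (spans j root∈K))) only-j
    where
    open SpanningTreeFrom tree
    only-j : ∀ i → (inK i ∧ is-nothing (lookup T i)) ≡ true → i ≡ j
    only-j i h with inTree⇒root (spans i (∧-conicalˡ _ _ h))
    ... | _ , _ , c = sym (climb-from-root (lookup-nothing (∧-conicalʳ (inK i) _ h)) c)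
      where
      lookup-nothing : ∀ {m : Maybe (Fin n)} → is-nothing m ≡ true → m ≡ nothing
      lookup-nothing {nothing} _ = refl

  spanning-tree-arcs : ∀ {j T} → SpanningTreeFrom j T → nArcs T ℕ.+ 1 ≡ |K|
  spanning-tree-arcs {T = T} tree = trans (cong (nArcs T ℕ.+_) (sym (spanning-tree-roots tree)))
                                  (arcs+roots (SpanningTreeFrom.spanning-forest tree))

  one-root⇒spanning-tree : ∀ {T} → IsForest ΓK T → rootsInK T ≡ 1 → ∃ λ r → SpanningTreeFrom r T
  one-root⇒spanning-tree {T} f one with climb-to-root (acyclic f) k₀
  ... | r , er , _ , c = r , record { root∈K = r∈K ; spanning-forest = f ; spans = spans }
    where
    r∈K : inK r ≡ true
    r∈K = climb-in-K f c (proj₂ nonempty)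
    spans : ∀ x → inK x ≡ true → inTree T r x ≡ true
    spans x hx with climb-to-root (acyclic f) x
    ... | r′ , er′ , _ , c′ with r′ ≟ r
    ...   | yes refl = root⇒inTree (acyclic f) er′ c′
    ...   | no r′≢r = ⊥-elim (ℕₚ.<-irrefl (sym one) (ℕₚ.<-≤-trans (ℕₚ.n<1+n 1)
                        (count-two _ r′ r r′≢r (∧-intro (climb-in-K f c′ hx) (cong is-nothing er′))
                                              (∧-intro r∈K (cong is-nothing er)))))

  reach-into-K : ∀ {a b} → Reach A a b → inK b ≡ true → inK a ≡ true × Reach ΓK a b
  reach-into-K here h = h , here
  reach-into-K (step {y = y} e r) h with reach-into-K r h
  ... | hy , r′ = no-entering _ y e hy , step (induced-arc-intro e (no-entering _ y e hy) hy) r′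

  spanning-tree-exists : ∀ j → inK j ≡ true → ∃ (SpanningTreeFrom j)
  spanning-tree-exists j hj = regrafted ,
    record { root∈K = hj ; spanning-forest = regrafted-forest (emptyPar-forest ΓK) (λ ()) ; spans = spans }
    where
    open Regraft ΓK j emptyPar nothing using (regrafted; regrafted-forest; regrafted-tree; reachable-complete)
    spans : ∀ x → inK x ≡ true → inTree regrafted j x ≡ true
    spans x hx = regrafted-tree (emptyPar-forest ΓK) (λ ()) refl x
                   (reachable-complete x (proj₂ (reach-into-K (mutual-reach j x hj hx) hx)))

  module Merge {T P F : Par n} (T-forest : IsForest ΓK T) (P-forest : IsForest Γ₋K P)
               (lookup-F : ∀ x → lookup F x ≡ (if inK x then lookup T x else lookup P x)) where

    lookup-F-∈ : ∀ x → inK x ≡ true → lookup F x ≡ lookup T x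
    lookup-F-∈ x h rewrite lookup-F x | h = refl

    lookup-F-∉ : ∀ x → inK x ≡ false → lookup F x ≡ lookup P x
    lookup-F-∉ x h rewrite lookup-F x | h = refl

    climb-from-K : ∀ {t u w} → Climb F t u w → inK u ≡ true → Climb T t u w
    climb-from-K stay             h = stay
    climb-from-K {u = u} (up e c) h with trans (sym (lookup-F-∈ u h)) e
    ... | e′ = up e′ (climb-from-K c (proj₁ (proj₂ (induced-arc (subgraph T-forest _ _ e′)))))

    climb-to-outside : ∀ {t u w} → Climb F t u w → inK w ≡ false → Climb P t u w
    climb-to-outside stay             h = stay
    climb-to-outside {u = u} (up e c) h with bool-cases (inK u)
    ... | inj₁ hu = ⊥-elim (true≢false (climb-in-K T-forest (climb-from-K (up e c) hu) hu) h)
    ... | inj₂ hu = up (trans (sym (lookup-F-∉ u hu)) e) (climb-to-outside c h)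

    merged-forest : IsForest A F
    merged-forest = mkForest sub ac
      where
      sub : SubgraphOf A F
      sub x p e with bool-cases (inK x)
      ... | inj₁ h = proj₁ (induced-arc (subgraph T-forest x p (trans (sym (lookup-F-∈ x h)) e)))
      ... | inj₂ h = proj₁ (minus-arc (subgraph P-forest x p (trans (sym (lookup-F-∉ x h)) e)))
      ac : Acyclic F
      ac {i = x} t≤n cycle with bool-cases (inK x)
      ... | inj₁ h = acyclic T-forest t≤n (climb-from-K cycle h)
      ... | inj₂ h = acyclic P-forest t≤n (climb-to-outside cycle h)

  lookup-inside-outside : ∀ (F : Par n) x → lookup F x ≡ (if inK x then lookup (inside K F) x else lookup (outside K F) x)
  lookup-inside-outside F x with bool-cases (inK x)
  ... | inj₁ h rewrite h | lookup-inside-∈ F x h = refl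
  ... | inj₂ h rewrite h | lookup-outside-∉ F x h = refl

  -- A forest of Γ has at most one less arc than |K| inside K and at most maxArcs Γ₋K outside K;
  -- a spanning tree of Γ_K merged with a maximum forest of Γ₋K attains both bounds.
  maxArcs-decomposition : maxArcs A ℕ.+ 1 ≡ |K| ℕ.+ maxArcs Γ₋K
  maxArcs-decomposition = ℕₚ.≤-antisym upper lower
    where
    open ℕₚ.≤-Reasoning
    shift-1 : ∀ a b → a ℕ.+ b ℕ.+ 1 ≡ a ℕ.+ (1 ℕ.+ b)
    shift-1 = solve-∀
    upper : maxArcs A ℕ.+ 1 ℕ.≤ |K| ℕ.+ maxArcs Γ₋K
    upper with maxArcs-attained A
    ... | F , f , nF = begin
      maxArcs A ℕ.+ 1                                 ≡⟨ cong (ℕ._+ 1) (trans (sym nF) (nArcs-inside-outside F)) ⟩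
      nArcs (inside K F) ℕ.+ nArcs (outside K F) ℕ.+ 1  ≡⟨ shift-1 (nArcs (inside K F)) (nArcs (outside K F)) ⟩
      nArcs (inside K F) ℕ.+ (1 ℕ.+ nArcs (outside K F))
        ≤⟨ ℕₚ.+-monoʳ-≤ (nArcs (inside K F)) (ℕₚ.+-mono-≤ (rootsInK-pos (inside-forest f))
                                                          (maxArcs-upper Γ₋K _ (outside-forest f))) ⟩
      nArcs (inside K F) ℕ.+ (rootsInK (inside K F) ℕ.+ maxArcs Γ₋K)
        ≡⟨ ℕₚ.+-assoc (nArcs (inside K F)) _ _ ⟨
      nArcs (inside K F) ℕ.+ rootsInK (inside K F) ℕ.+ maxArcs Γ₋K
        ≡⟨ cong (ℕ._+ maxArcs Γ₋K) (arcs+roots (inside-forest f)) ⟩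
      |K| ℕ.+ maxArcs Γ₋K                             ∎
    lower : |K| ℕ.+ maxArcs Γ₋K ℕ.≤ maxArcs A ℕ.+ 1
    lower with spanning-tree-exists k₀ (proj₂ nonempty) | maxArcs-attained Γ₋K
    ... | T , tree | P , P-forest , nP = begin
      |K| ℕ.+ maxArcs Γ₋K                             ≡⟨ cong₂ ℕ._+_ (sym (spanning-tree-arcs tree)) (sym nP) ⟩
      nArcs T ℕ.+ 1 ℕ.+ nArcs P                       ≡⟨ trans (ℕₚ.+-assoc (nArcs T) 1 (nArcs P)) (sym (shift-1 (nArcs T) (nArcs P))) ⟩
      nArcs T ℕ.+ nArcs P ℕ.+ 1                       ≡⟨ cong (ℕ._+ 1) (trans (cong₂ ℕ._+_ same-inside same-outside) (sym (nArcs-inside-outside F))) ⟩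
      nArcs F ℕ.+ 1                                   ≤⟨ ℕₚ.+-monoˡ-≤ 1 (maxArcs-upper A F merged-forest) ⟩
      maxArcs A ℕ.+ 1                                 ∎
      where
      F : Par n
      F = Vec.tabulate λ x → if inK x then lookup T x else lookup P x
      open Merge {F = F} (SpanningTreeFrom.spanning-forest tree) P-forest (Vecₚ.lookup∘tabulate _)
      same-inside : nArcs T ≡ nArcs (inside K F)
      same-inside = trans (nArcs≡count T) (trans (count-cong agree) (sym (nArcs≡count (inside K F))))
        where
        agree : ∀ x → hasParent T x ≡ hasParent (inside K F) x
        agree x with bool-cases (inK x)
        ... | inj₁ h = cong is-just (sym (trans (lookup-inside-∈ F x h) (lookup-F-∈ x h)))
        ... | inj₂ h = cong is-just (trans (induced-root-outside (SpanningTreeFrom.spanning-forest tree) x h)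
                                           (sym (lookup-inside-∉ F x h)))
      same-outside : nArcs P ≡ nArcs (outside K F)
      same-outside = trans (nArcs≡count P) (trans (count-cong agree) (sym (nArcs≡count (outside K F))))
        where
        agree : ∀ x → hasParent P x ≡ hasParent (outside K F) x
        agree x with bool-cases (inK x)
        ... | inj₁ h = cong is-just (trans (minus-root-inside P-forest x h) (sym (lookup-outside-∈ F x h)))
        ... | inj₂ h = cong is-just (sym (trans (lookup-outside-∉ F x h) (lookup-F-∉ x h)))

  maximum⇒split : ∀ {F} → IsMaximum A F →
                  (∃ λ r → SpanningTreeFrom r (inside K F)) × IsMaximum Γ₋K (outside K F)
  maximum⇒split {F} (mkMaximum f nF) =
    one-root⇒spanning-tree (inside-forest f) rS≡1 , mkMaximum (outside-forest f) nC≡mB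
    where
    nS = nArcs (inside K F)
    nC = nArcs (outside K F)
    rS = rootsInK (inside K F)
    mB = maxArcs Γ₋K
    balance : nC ℕ.+ 1 ≡ rS ℕ.+ mB
    balance = ℕₚ.+-cancelˡ-≡ nS _ _ (begin
      nS ℕ.+ (nC ℕ.+ 1)     ≡⟨ ℕₚ.+-assoc nS nC 1 ⟨
      nS ℕ.+ nC ℕ.+ 1       ≡⟨ cong (ℕ._+ 1) (trans (sym (nArcs-inside-outside F)) nF) ⟩
      maxArcs A ℕ.+ 1       ≡⟨ maxArcs-decomposition ⟩
      |K| ℕ.+ mB            ≡⟨ cong (ℕ._+ mB) (arcs+roots (inside-forest f)) ⟨
      nS ℕ.+ rS ℕ.+ mB      ≡⟨ ℕₚ.+-assoc nS rS mB ⟩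
      nS ℕ.+ (rS ℕ.+ mB)    ∎)
      where open ≡-Reasoning
    rS≤1 : rS ℕ.≤ 1
    rS≤1 = ℕₚ.+-cancelʳ-≤ mB rS 1 (begin
      rS ℕ.+ mB   ≡⟨ balance ⟨
      nC ℕ.+ 1    ≤⟨ ℕₚ.+-monoˡ-≤ 1 (maxArcs-upper Γ₋K _ (outside-forest f)) ⟩
      mB ℕ.+ 1    ≡⟨ ℕₚ.+-comm mB 1 ⟩
      1 ℕ.+ mB    ∎)
      where open ℕₚ.≤-Reasoning
    rS≡1 : rS ≡ 1
    rS≡1 = ℕₚ.≤-antisym rS≤1 (rootsInK-pos (inside-forest f))
    nC≡mB : nC ≡ mB
    nC≡mB = ℕₚ.+-cancelʳ-≡ 1 nC mB (trans balance (trans (cong (ℕ._+ mB) rS≡1) (ℕₚ.+-comm 1 mB)))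

  split⇒maximum : ∀ {F r} → SpanningTreeFrom r (inside K F) → IsMaximum Γ₋K (outside K F) → IsMaximum A F
  split⇒maximum {F} tree (mkMaximum P-forest nP) = mkMaximum merged-forest (ℕₚ.+-cancelʳ-≡ 1 _ _ (begin
    nArcs F ℕ.+ 1                                           ≡⟨ cong (ℕ._+ 1) (nArcs-inside-outside F) ⟩
    nArcs (inside K F) ℕ.+ nArcs (outside K F) ℕ.+ 1        ≡⟨ shift-1 (nArcs (inside K F)) (nArcs (outside K F)) ⟩
    nArcs (inside K F) ℕ.+ 1 ℕ.+ nArcs (outside K F)        ≡⟨ cong₂ ℕ._+_ (spanning-tree-arcs tree) nP ⟩
    |K| ℕ.+ maxArcs Γ₋K                                     ≡⟨ maxArcs-decomposition ⟨
    maxArcs A ℕ.+ 1                                         ∎))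
    where
    open ≡-Reasoning
    open Merge {F = F} (SpanningTreeFrom.spanning-forest tree) P-forest (lookup-inside-outside F)
    shift-1 : ∀ a b → a ℕ.+ b ℕ.+ 1 ≡ a ℕ.+ 1 ℕ.+ b
    shift-1 = solve-∀

  𝓟⇒IsMaximum : ∀ {P} → 𝓟 A K P ≡ true → IsMaximum Γ₋K P
  𝓟⇒IsMaximum = counted⇒IsMaximum refl

  IsMaximum⇒𝓟 : ∀ {P} → IsMaximum Γ₋K P → 𝓟 A K P ≡ true
  IsMaximum⇒𝓟 = IsMaximum⇒counted refl

  climb-to-K : ∀ {F t u w} → Climb F t u w → inK w ≡ true →
               ∃ λ k → inK k ≡ true × ∃ λ t′ → Climb (outside K F) t′ u k
  climb-to-K stay hw = _ , hw , 0 , stay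
  climb-to-K {F} {u = u} (up e c) hw with bool-cases (inK u)
  ... | inj₁ hu = u , hu , 0 , stay
  ... | inj₂ hu with climb-to-K c hw
  ...   | k , hk , t′ , c′ = k , hk , suc t′ , up (trans (lookup-outside-∉ F u hu) e) c′

  m : ℕ
  m = n ∸ forestDim A

  𝓕→-split : ∀ {j} i → inK j ≡ true → ∀ F →
             𝓕→ A m j i F ≡ (𝓣from A K j (inside K F) ∧ 𝓟K→ A K i (outside K F))
  𝓕→-split {j} i hj F = bool-ext to from
    where
    to : 𝓕→ A m j i F ≡ true → (𝓣from A K j (inside K F) ∧ 𝓟K→ A K i (outside K F)) ≡ true
    to h = split-to (maximum⇒split (𝓕⇒IsMaximum (∧-conicalˡ _ _ h))) (inTree⇒root (∧-conicalʳ (𝓕 A m F) _ h))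
      where
      split-to : (∃ λ r → SpanningTreeFrom r (inside K F)) × IsMaximum Γ₋K (outside K F) →
                 lookup F j ≡ nothing × (∃ λ t → Climb F t i j) →
                 (𝓣from A K j (inside K F) ∧ 𝓟K→ A K i (outside K F)) ≡ true
      split-to ((r , tree) , P-max) (j-root , _ , c) = ∧-intro tree-from-j reaches-K
        where
        r≡j : r ≡ j
        r≡j = climb-from-root (trans (lookup-inside-∈ F j hj) j-root)
                              (proj₂ (proj₂ (inTree⇒root (SpanningTreeFrom.spans tree j hj))))
        tree-from-j : 𝓣from A K j (inside K F) ≡ true
        tree-from-j = SpanningTreeFrom⇒𝓣from (subst (λ x → SpanningTreeFrom x (inside K F)) r≡j tree)
        reaches-K : 𝓟K→ A K i (outside K F) ≡ true
        reaches-K with climb-to-K c hj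
        ... | k , hk , _ , c′ = ∧-intro (IsMaximum⇒𝓟 P-max)
          (any-allFin⁺ _ k (∧-intro hk (Climb⇒anc c′ n (ℕₚ.<⇒≤ (climb-bounded (acyclic (forest P-max)) c′)))))
    from : (𝓣from A K j (inside K F) ∧ 𝓟K→ A K i (outside K F)) ≡ true → 𝓕→ A m j i F ≡ true
    from h = merge-from (any⁻ _ {allFin n} (∧-conicalʳ (𝓟 A K (outside K F)) _ hP))
      where
      tree = 𝓣from⇒SpanningTreeFrom (∧-conicalˡ _ _ h)
      hP = ∧-conicalʳ (𝓣from A K j (inside K F)) _ h
      F-max : IsMaximum A F
      F-max = split⇒maximum tree (𝓟⇒IsMaximum (∧-conicalˡ _ _ hP))
      merge-from : (∃ λ k → (inK k ∧ anc n (outside K F) i k) ≡ true) → 𝓕→ A m j i F ≡ true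
      merge-from (k , hk) = ∧-intro (IsMaximum⇒𝓕 F-max)
        (root⇒inTree (acyclic (forest F-max)) (trans (sym (lookup-inside-∈ F j hj)) (proj₁ (inTree⇒root (spans j hj))))
                     (climb-++ (climb-⊑ (outside-⊑ F) i⇝k) (climb-⊑ (inside-⊑ F) k⇝j)))
        where
        open SpanningTreeFrom tree
        i⇝k = proj₂ (proj₂ (anc⇒Climb n (∧-conicalʳ (inK k) _ hk)))
        k⇝j = proj₂ (proj₂ (inTree⇒root (spans k (∧-conicalˡ _ _ hk))))

  𝓕-split : ∀ F → 𝓕 A m F ≡ (𝓣 A K (inside K F) ∧ 𝓟 A K (outside K F))
  𝓕-split F = bool-ext to from
    where
    to : 𝓕 A m F ≡ true → (𝓣 A K (inside K F) ∧ 𝓟 A K (outside K F)) ≡ true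
    to h = split-to (maximum⇒split (𝓕⇒IsMaximum h))
      where
      split-to : (∃ λ r → SpanningTreeFrom r (inside K F)) × IsMaximum Γ₋K (outside K F) →
                 (𝓣 A K (inside K F) ∧ 𝓟 A K (outside K F)) ≡ true
      split-to ((r , tree) , P-max) = ∧-intro (any-allFin⁺ _ r (SpanningTreeFrom⇒𝓣from tree)) (IsMaximum⇒𝓟 P-max)
    from : (𝓣 A K (inside K F) ∧ 𝓟 A K (outside K F)) ≡ true → 𝓕 A m F ≡ true
    from h = IsMaximum⇒𝓕 (split⇒maximum (𝓣from⇒SpanningTreeFrom (proj₂ (any⁻ _ {allFin n} (∧-conicalˡ _ _ h))))
                                        (𝓟⇒IsMaximum (∧-conicalʳ (𝓣 A K (inside K F)) _ h)))

  minus-reach-into-K : ∀ {a b} → Reach Γ₋K a b → inK b ≡ true → a ≡ b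
  minus-reach-into-K here       hb = refl
  minus-reach-into-K (step e r) hb with minus-reach-into-K r hb
  ... | refl = ⊥-elim (true≢false hb (proj₂ (minus-arc e)))

  minus-knot⇒knot : ∀ {K″ r} → UndomKnot Γ₋K K″ → (r ∈ᵇ K″) ≡ true → inK r ≡ false → UndomKnot A K″
  minus-knot⇒knot {K″} {r} knot″ r∈K″ r∉K = record
    { nonempty     = K″.nonempty
    ; mutual-reach = λ a b ha hb → reach-mono (λ _ _ e → proj₁ (minus-arc e)) (K″.mutual-reach a b ha hb)
    ; no-entering  = λ a b e hb → K″.no-entering a b (minus-arc-intro e (outside-K b hb)) hb
    }
    where
    module K″ = UndomKnot knot″
    outside-K : ∀ k → (k ∈ᵇ K″) ≡ true → inK k ≡ false
    outside-K k hk with bool-cases (inK k)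
    ... | inj₂ k∉K = k∉K
    ... | inj₁ k∈K with minus-reach-into-K (K″.mutual-reach r k r∈K″ hk) k∈K
    ...   | refl = ⊥-elim (true≢false k∈K r∉K)

module Weighted {n} (A : Arcs n) (ε : Weights n) (ε-pos : ∀ i j → A i j ≡ true → 0ℚ <ℚ ε i j) where

  m : ℕ
  m = n ∸ forestDim A

  D : ℚ
  D = ε𝓕 A ε

  wt-pos-within : ∀ {B : Arcs n} → (∀ a b → B a b ≡ true → A a b ≡ true) → ∀ {P} → IsForest B P → 0ℚ <ℚ wt ε P
  wt-pos-within B⊆A {P} f = wt-pos ε P (λ i j e → ε-pos j i (B⊆A j i (subgraph f i j e)))

  maximum-wt-pos : ∀ {P} → IsMaximum A P → 0ℚ <ℚ wt ε P
  maximum-wt-pos P-max = wt-pos-within (λ _ _ e → e) (forest P-max)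

  𝓕-wt-nonneg : ∀ P → 𝓕 A m P ≡ true → 0ℚ ≤ wt ε P
  𝓕-wt-nonneg P h = ℚₚ.<⇒≤ (maximum-wt-pos (𝓕⇒IsMaximum {P = P} h))

  D-pos : 0ℚ <ℚ D
  D-pos with maximum-exists {A = A}
  ... | F , F-max = wset-pos ε (𝓕 A m) 𝓕-wt-nonneg F (IsMaximum⇒𝓕 F-max) (maximum-wt-pos F-max)

  D≢0 : D ≢ 0ℚ
  D≢0 = pos⇒≢0 D-pos

  Jbar-nonneg : ∀ i j → 0ℚ ≤ Jbar A ε i j
  Jbar-nonneg i j = /ℚ-nonneg D-pos (wset-nonneg ε (𝓕→ A m j i) (λ P h → 𝓕-wt-nonneg P (∧-conicalˡ _ _ h)))

  -- Every vertex lies in exactly one tree of each maximum forest.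
  Q-row-sum : ∀ i → sum (Q A ε i) ≡ D
  Q-row-sum i = wset-partition ε (𝓕 A m) (λ k → 𝓕→ A m k i) (λ k P h → ∧-conicalˡ _ _ h) one-tree
    where
    one-tree : ∀ P → 𝓕 A m P ≡ true → ∃ λ k → 𝓕→ A m k i P ≡ true × ∀ k′ → 𝓕→ A m k′ i P ≡ true → k′ ≡ k
    one-tree P h with tree-of (acyclic (forest (𝓕⇒IsMaximum {P = P} h))) i
    ... | r , hr = r , ∧-intro h hr , λ k′ h′ → inTree-unique (∧-conicalʳ (𝓕 A m P) _ h′) hr

  Jbar-row-sum : ∀ i → Σv (Jbar A ε i) ≡ 1ℚ
  Jbar-row-sum i = begin
    Σv (Jbar A ε i)                ≡⟨ Σv≡sum (Jbar A ε i) ⟩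
    sum (λ k → Q A ε i k /ℚ D)     ≡⟨ sum-/ℚ D≢0 (Q A ε i) ⟩
    sum (Q A ε i) /ℚ D             ≡⟨ cong (_/ℚ D) (Q-row-sum i) ⟩
    D /ℚ D                         ≡⟨ /ℚ-self D≢0 ⟩
    1ℚ                             ∎
    where open ≡-Reasoning

  Jbar-support : ∀ i j → (Jbar A ε i j ≢ 0ℚ) ⇔ (InKtilde A j × Reach A j i)
  Jbar-support i j = mk⇔ to from
    where
    to : Jbar A ε i j ≢ 0ℚ → InKtilde A j × Reach A j i
    to J≢0 with wset-≢0 ε (𝓕→ A m j i) (/ℚ-≢0 (Q A ε i j) D J≢0)
    ... | F , hF with 𝓕⇒IsMaximum {P = F} (∧-conicalˡ _ _ hF) | inTree⇒root {P = F} (∧-conicalʳ (𝓕 A m F) _ hF)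
    ...   | F-max | j-root , _ , c = maximum-root-in-knot A F-max j j-root , climb⇒reach (subgraph (forest F-max)) c
    from : InKtilde A j × Reach A j i → Jbar A ε i j ≢ 0ℚ
    from ((K′ , knot′ , j∈K′) , j⇝i) with maximum-through A knot′ j j∈K′ i j⇝i
    ... | G , G-max , i-under-j = pos⇒≢0 (/ℚ-pos D-pos (wset-pos ε (𝓕→ A m j i)
                                    (λ P h → 𝓕-wt-nonneg P (∧-conicalˡ _ _ h))
                                    G (∧-intro (IsMaximum⇒𝓕 G-max) i-under-j) (maximum-wt-pos G-max)))

  Jbar-undominated : ∀ j → Undominated A j → Jbar A ε j j ≡ 1ℚ
  Jbar-undominated j undominated = trans (cong (_/ℚ D) Q≡D) (/ℚ-self D≢0)
    where
    own-tree : ∀ F → 𝓕 A m F ≡ true → inTree F j j ≡ true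
    own-tree F h with lookup F j in e
    ... | nothing = Climb⇒anc stay n z≤n
    ... | just p  = ⊥-elim (true≢false (subgraph (forest (𝓕⇒IsMaximum {P = F} h)) j p e) (undominated p))
    Q≡D : Q A ε j j ≡ D
    Q≡D = wset-cong ε (λ F → bool-ext (∧-conicalˡ _ _) (λ h → ∧-intro h (own-tree F h)))

  module AtKnot (K : VSet n) (knot : UndomKnot A K) where

    open KnotDecomposition A K knot
      hiding (m)

    ε𝓣from : Fin n → ℚ
    ε𝓣from j = wset ε (𝓣from A K j)

    ε𝓟K→ : Fin n → ℚ
    ε𝓟K→ i = wset ε (𝓟K→ A K i)

    ε𝓣 ε𝓟 : ℚ
    ε𝓣 = wset ε (𝓣 A K)
    ε𝓟 = wset ε (𝓟 A K)

    tree-supported : ∀ {j} T → 𝓣from A K j T ≡ true → supportedIn K T ≡ true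
    tree-supported T h = supportedIn-intro K T
      (induced-root-outside (SpanningTreeFrom.spanning-forest (𝓣from⇒SpanningTreeFrom h)))

    trees-supported : ∀ T → 𝓣 A K T ≡ true → supportedIn K T ≡ true
    trees-supported T h = tree-supported T (proj₂ (any⁻ _ {allFin n} h))

    outer-supported : ∀ P → 𝓟 A K P ≡ true → supportedIn (Vec.map not K) P ≡ true
    outer-supported P h = supportedIn-intro (Vec.map not K) P λ i out →
      minus-root-inside (forest (𝓟⇒IsMaximum {P = P} h)) i
                        (not-injective {y = true} (trans (sym (Vecₚ.lookup-map i not K)) out))

    Q-factorisation : ∀ i j → inK j ≡ true → Q A ε i j ≡ ε𝓣from j * ε𝓟K→ i
    Q-factorisation i j hj = wset-product ε K (𝓕→ A m j i) (𝓣from A K j) (𝓟K→ A K i) (𝓕→-split i hj)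
                                          (tree-supported {j}) (λ P h → outer-supported P (∧-conicalˡ _ _ h))

    D-factorisation : D ≡ ε𝓣 * ε𝓟
    D-factorisation = wset-product ε K (𝓕 A m) (𝓣 A K) (𝓟 A K) 𝓕-split trees-supported outer-supported

    private
      nonneg-on : ∀ {B : Arcs n} → (∀ a b → B a b ≡ true → A a b ≡ true) → (S : Par n → Bool) →
                  (∀ P → S P ≡ true → IsForest B P) → ∀ P → S P ≡ true → 0ℚ ≤ wt ε P
      nonneg-on B⊆A S forest-of P h = ℚₚ.<⇒≤ (wt-pos-within B⊆A (forest-of P h))

      ΓK⊆A : ∀ a b → ΓK a b ≡ true → A a b ≡ true
      ΓK⊆A a b e = proj₁ (induced-arc e)

      Γ₋K⊆A : ∀ a b → Γ₋K a b ≡ true → A a b ≡ true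
      Γ₋K⊆A a b e = proj₁ (minus-arc e)

      tree-wt-nonneg : ∀ j P → 𝓣from A K j P ≡ true → 0ℚ ≤ wt ε P
      tree-wt-nonneg j = nonneg-on ΓK⊆A (𝓣from A K j)
                                   (λ P h → SpanningTreeFrom.spanning-forest (𝓣from⇒SpanningTreeFrom h))

    ε𝓣from-pos : ∀ j → inK j ≡ true → 0ℚ <ℚ ε𝓣from j
    ε𝓣from-pos j hj with spanning-tree-exists j hj
    ... | T , tree = wset-pos ε (𝓣from A K j) (tree-wt-nonneg j) T (SpanningTreeFrom⇒𝓣from tree)
                       (wt-pos-within ΓK⊆A (SpanningTreeFrom.spanning-forest tree))

    ε𝓣-pos : 0ℚ <ℚ ε𝓣
    ε𝓣-pos with spanning-tree-exists k₀ (proj₂ (UndomKnot.nonempty knot))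
    ... | T , tree = wset-pos ε (𝓣 A K) (λ T h → tree-wt-nonneg _ T (proj₂ (any⁻ _ {allFin n} h))) T
                       (any-allFin⁺ _ k₀ (SpanningTreeFrom⇒𝓣from tree))
                       (wt-pos-within ΓK⊆A (SpanningTreeFrom.spanning-forest tree))

    ε𝓟-pos : 0ℚ <ℚ ε𝓟
    ε𝓟-pos with maximum-exists {A = Γ₋K}
    ... | P , P-max = wset-pos ε (𝓟 A K) (nonneg-on Γ₋K⊆A (𝓟 A K) (λ P h → forest (𝓟⇒IsMaximum h))) P
                        (IsMaximum⇒𝓟 P-max) (wt-pos-within Γ₋K⊆A (forest P-max))

    Jbar-knot-column : ∀ j → inK j ≡ true → ∀ i → Jbar A ε i j ≡ (ε𝓣from j * ε𝓟K→ i) /ℚ D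
    Jbar-knot-column j hj i = cong (_/ℚ D) (Q-factorisation i j hj)

    ε𝓟K→-everywhere : ∀ i → (∀ P → 𝓟 A K P ≡ true → any (λ k → inK k ∧ anc n P i k) (allFin n) ≡ true) →
                      ε𝓟K→ i ≡ ε𝓟
    ε𝓟K→-everywhere i reaches = wset-cong ε (λ P → bool-ext (∧-conicalˡ _ _) (λ h → ∧-intro h (reaches P h)))

    ε𝓟K→-knot : ∀ j → inK j ≡ true → ε𝓟K→ j ≡ ε𝓟
    ε𝓟K→-knot j hj = ε𝓟K→-everywhere j (λ P _ → any-allFin⁺ _ j (∧-intro hj (Climb⇒anc stay n z≤n)))


    -- The root of i's tree in a maximum forest of Γ₋K lies in an undominated knot of Γ₋K; outside K
    -- that is an undominated knot of Γ other than K, from which i is reachable.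
    ε𝓟K→-Kplus : ∀ i → InKplus A K i → ε𝓟K→ i ≡ ε𝓟
    ε𝓟K→-Kplus i i∈K⁺ = ε𝓟K→-everywhere i reaches
      where
      open InKplus i∈K⁺
      reaches : ∀ P → 𝓟 A K P ≡ true → any (λ k → inK k ∧ anc n P i k) (allFin n) ≡ true
      reaches P h = from-root (climb-to-root (acyclic (forest P-max)) i)
        where
        P-max : IsMaximum Γ₋K P
        P-max = 𝓟⇒IsMaximum {P = P} h
        from-root : (∃ λ r → lookup P r ≡ nothing × ∃ λ t → Climb P t i r) →
                    any (λ k → inK k ∧ anc n P i k) (allFin n) ≡ true
        from-root (r , r-root , _ , c) with bool-cases (inK r)
        ... | inj₁ r∈K = any-allFin⁺ _ r (∧-intro r∈K (Climb⇒anc c n (ℕₚ.<⇒≤ (climb-bounded (acyclic (forest P-max)) c))))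
        ... | inj₂ r∉K = ⊥-elim (notOther K″ (minus-knot⇒knot knot″ r∈K″ r∉K) K″≢K r r∈K″
                                          (reach-mono Γ₋K⊆A (climb⇒reach (subgraph (forest P-max)) c)))
          where
          r-knot = maximum-root-in-knot Γ₋K P-max r r-root
          K″ = proj₁ r-knot
          knot″ = proj₁ (proj₂ r-knot)
          r∈K″ = proj₂ (proj₂ r-knot)
          K″≢K : K″ ≢ K
          K″≢K K″≡K = true≢false (subst (λ L → (r ∈ᵇ L) ≡ true) K″≡K r∈K″) r∉K

    Jbar-Kplus : ∀ j → inK j ≡ true → ∀ i → InKplus A K i → Jbar A ε i j ≡ Jbar A ε j j
    Jbar-Kplus j hj i i∈K⁺ = begin
      Jbar A ε i j                   ≡⟨ Jbar-knot-column j hj i ⟩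
      (ε𝓣from j * ε𝓟K→ i) /ℚ D       ≡⟨ cong (λ x → (ε𝓣from j * x) /ℚ D) (trans (ε𝓟K→-Kplus i i∈K⁺) (sym (ε𝓟K→-knot j hj))) ⟩
      (ε𝓣from j * ε𝓟K→ j) /ℚ D       ≡⟨ Jbar-knot-column j hj j ⟨
      Jbar A ε j j                   ∎
      where open ≡-Reasoning

    Jbar-knot-diagonal : ∀ j → inK j ≡ true → Jbar A ε j j ≡ ε𝓣from j /ℚ ε𝓣
    Jbar-knot-diagonal j hj = begin
      Jbar A ε j j                   ≡⟨ Jbar-knot-column j hj j ⟩
      (ε𝓣from j * ε𝓟K→ j) /ℚ D       ≡⟨ cong₂ (λ x y → (ε𝓣from j * x) /ℚ y) (ε𝓟K→-knot j hj) D-factorisation ⟩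
      (ε𝓣from j * ε𝓟) /ℚ (ε𝓣 * ε𝓟)   ≡⟨ /ℚ-cancelʳ (ε𝓣from j) ε𝓣-pos ε𝓟-pos ⟩
      ε𝓣from j /ℚ ε𝓣                 ∎
      where open ≡-Reasoning

    -- A spanning tree of Γ_K diverges from exactly one vertex.
    ε𝓣≡sum : ε𝓣 ≡ sum ε𝓣from
    ε𝓣≡sum = sym (wset-partition ε (𝓣 A K) (𝓣from A K) (λ j T h → any-allFin⁺ _ j h) one-root)
      where
      one-root : ∀ T → 𝓣 A K T ≡ true → ∃ λ j → 𝓣from A K j T ≡ true × ∀ j′ → 𝓣from A K j′ T ≡ true → j′ ≡ j
      one-root T h with any⁻ _ {allFin n} h
      ... | j , hj = j , hj , λ j′ hj′ → root-unique (𝓣from⇒SpanningTreeFrom hj) (𝓣from⇒SpanningTreeFrom hj′)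
        where
        root-unique : ∀ {j j′} → SpanningTreeFrom j T → SpanningTreeFrom j′ T → j′ ≡ j
        root-unique {j} tree tree′ =
          climb-from-root (proj₁ (inTree⇒root (SpanningTreeFrom.spans tree j (SpanningTreeFrom.root∈K tree))))
                          (proj₂ (proj₂ (inTree⇒root (SpanningTreeFrom.spans tree′ j (SpanningTreeFrom.root∈K tree)))))

    Jbar-knot-trace : ΣK K (λ j → Jbar A ε j j) ≡ 1ℚ
    Jbar-knot-trace = begin
      ΣK K (λ j → Jbar A ε j j)                    ≡⟨ Σv≡sum (λ j → if inK j then Jbar A ε j j else 0ℚ) ⟩
      sum (λ j → if inK j then Jbar A ε j j else 0ℚ) ≡⟨ sum-cong-≗ diagonal ⟩
      sum (λ j → (ε𝓣from j * ε𝓟) /ℚ D)             ≡⟨ sum-/ℚ D≢0 (λ j → ε𝓣from j * ε𝓟) ⟩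
      sum (λ j → ε𝓣from j * ε𝓟) /ℚ D               ≡⟨ cong (_/ℚ D) (*-distribʳ-sum ε𝓟 ε𝓣from) ⟨
      (sum ε𝓣from * ε𝓟) /ℚ D                       ≡⟨ cong (λ x → (x * ε𝓟) /ℚ D) ε𝓣≡sum ⟨
      (ε𝓣 * ε𝓟) /ℚ D                               ≡⟨ cong (_/ℚ D) D-factorisation ⟨
      D /ℚ D                                       ≡⟨ /ℚ-self D≢0 ⟩
      1ℚ                                           ∎
      where
      open ≡-Reasoning
      diagonal : ∀ j → (if inK j then Jbar A ε j j else 0ℚ) ≡ (ε𝓣from j * ε𝓟) /ℚ D
      diagonal j with bool-cases (inK j)
      ... | inj₁ hj = trans (if-true hj) (trans (Jbar-knot-column j hj j) (cong (λ x → (ε𝓣from j * x) /ℚ D) (ε𝓟K→-knot j hj)))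
      ... | inj₂ hj = trans (if-false hj) (sym (begin
        (ε𝓣from j * ε𝓟) /ℚ D   ≡⟨ cong (λ x → (x * ε𝓟) /ℚ D) (wset-empty ε (𝓣from A K j) (λ T → ∧-falseˡ _ hj)) ⟩
        (0ℚ * ε𝓟) /ℚ D         ≡⟨ cong (_/ℚ D) (ℚₚ.*-zeroˡ ε𝓟) ⟩
        0ℚ /ℚ D                ≡⟨ 0/ℚ D ⟩
        0ℚ                     ∎))

    Jbar-columns-proportional : ∀ j₁ j₂ → inK j₁ ≡ true → inK j₂ ≡ true → ∀ i →
                                Jbar A ε i j₂ ≡ (ε𝓣from j₂ /ℚ ε𝓣from j₁) * Jbar A ε i j₁
    Jbar-columns-proportional j₁ j₂ h₁ h₂ i = begin
      Jbar A ε i j₂                                      ≡⟨ Jbar-knot-column j₂ h₂ i ⟩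
      (ε𝓣from j₂ * ε𝓟K→ i) /ℚ D                          ≡⟨ /ℚ-rescale (ε𝓣from j₂) (ε𝓟K→ i) (pos⇒≢0 (ε𝓣from-pos j₁ h₁)) D≢0 ⟩
      (ε𝓣from j₂ /ℚ ε𝓣from j₁) * ((ε𝓣from j₁ * ε𝓟K→ i) /ℚ D) ≡⟨ cong ((ε𝓣from j₂ /ℚ ε𝓣from j₁) *_) (Jbar-knot-column j₁ h₁ i) ⟨
      (ε𝓣from j₂ /ℚ ε𝓣from j₁) * Jbar A ε i j₁           ∎
      where open ≡-Reasoning

theorem2 : (n : ℕ) → 1 < n →
    (A : Arcs n) → Loopless A →
    (ε : Weights n) → (∀ i j → A i j ≡ true → 0ℚ <ℚ ε i j) →
    (K : VSet n) → UndomKnot A K →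
    -- 1. J̄ is stochastic
    ((∀ i j → 0ℚ ≤ Jbar A ε i j) × (∀ i → Σv (λ k → Jbar A ε i k) ≡ 1ℚ))
    -- 2. support of J̄
    × (∀ i j → (Jbar A ε i j ≢ 0ℚ) ⇔ (InKtilde A j × Reach A j i))
    -- 3. columns indexed by K
    × (∀ j → (j ∈ᵇ K) ≡ true →
         (∀ i → Jbar A ε i j
                ≡ (wset ε (𝓣from A K j) * wset ε (𝓟K→ A K i)) /ℚ ε𝓕 A ε)
         × (∀ i → InKplus A K i →
              (Jbar A ε i j ≡ Jbar A ε j j)
              × (Jbar A ε j j ≡ wset ε (𝓣from A K j) /ℚ wset ε (𝓣 A K))))
    -- 4. diagonal entries over K sum to 1; undominated vertices have J̄_jj = 1
    × (ΣK K (λ j → Jbar A ε j j) ≡ 1ℚ)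
    × (∀ j → Undominated A j → Jbar A ε j j ≡ 1ℚ)
    -- 5. proportional columns
    × (∀ j₁ j₂ → (j₁ ∈ᵇ K) ≡ true → (j₂ ∈ᵇ K) ≡ true →
         ∀ i → Jbar A ε i j₂
               ≡ (wset ε (𝓣from A K j₂) /ℚ wset ε (𝓣from A K j₁)) * Jbar A ε i j₁)
theorem2 n _ A _ ε ε-pos K knot =
  (Jbar-nonneg , Jbar-row-sum) ,
  Jbar-support ,
  (λ j j∈K → Jbar-knot-column j j∈K , λ i i∈K⁺ → Jbar-Kplus j j∈K i i∈K⁺ , Jbar-knot-diagonal j j∈K) ,
  Jbar-knot-trace ,
  Jbar-undominated ,
  Jbar-columns-proportional
  where
  open Weighted A ε ε-pos
  open AtKnot K knot
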